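{- Let $\nu$ be a complex number that is not a negative integer, and let $D_{n,\nu}(q) = \prod_{k=1}^n [k+\nu]_q^{\lfloor n/k \rfloor}$. Then there exist polynomials $N_{n,\nu}(q)$, $n\ge1$, in $q$, $q^\nu$ and $[\nu]_q$ with nonnegative integer coefficients such that, as formal power series in $z$, both \[ \frac{J_{\nu+1}((1-q)z;q^{ -1})}{J_\nu((1-q)z;q^{ -1})} = - \sum_{n=1}^{\infty} \frac{N_{n,\nu}(q)}{D_{n,\nu}(q)} q^{(\nu+1)n} z^{2n-1} \] and \[ \frac{J_{\nu+1}((1-q)z;q)}{J_\nu((1-q)z;q)} = (1-q)z + \sum_{n\ge1}\frac{N_{n,\nu}(q)}{D_{n,\nu}(q)} q^{n+\nu} z^{2n-1} \] hold.
   Context: Notation: $(a;p)_n=(1-a)(1-ap)\cdots(1-ap^{n-1})$, $(a;p)_\infty=\prod_{i\ge0}(1-ap^i)$, and $[x]_q=(1-q^x)/(1-q)$. The Hahn–Exton $q$-Bessel function with base $p$ is $J_\nu(w;p)=\frac{(p^{\nu+1};p)_\infty w^\nu}{(p;p)_\infty}\Phi_\nu(w;p)$, where $\Phi_\nu(w;p)=\sum_{n\ge0}\frac{(-1)^n p^{\binom n2}(p w^2)^n}{(p;p)_n(p^{\nu+1};p)_n}$. Consequently $\frac{J_{\nu+1}(w;p)}{J_\nu(w;p)}=\frac{w}{1-p^{\nu+1}}\cdot\frac{\Phi_{\nu+1}(w;p)}{\Phi_\nu(w;p)}$; for base $p=q^{ -1}$ the ratio is understood as this formal power series in $w$, whose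 coefficients are rational functions of $q$ and $q^\nu$. -}

module Defs where

open import Level using (0ℓ)
open import Algebra.Bundles using (CommutativeRing)
open import Data.Nat as ℕ using (ℕ; zero; suc; _∸_)
open import Data.Nat.DivMod using (_/_)
open import Data.Nat.Combinatorics using (_C_)
open import Data.List using (List; []; _∷_)
open import Data.Product using (_×_; _,_)

-- A polynomial in three variables X, Y, B with NONNEGATIVE INTEGER coefficients:
-- a list of monomials (c , i , j , k) standing for  c * X^i * Y^j * B^k .
-- (Here X = q, Y = q^ν, B = [ν]_q.)
Poly3 : Set
Poly3 = List (ℕ × ℕ × ℕ × ℕ)

-- The paper's q and q^ν
-- are represented by ring elements q and t ( = q^ν ), formal power series in z
-- by their coefficient sequences ℕ → Carrier.
module Q (R : CommutativeRing 0ℓ 0ℓ) where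
  open CommutativeRing R hiding (zero)

  pow : Carrier → ℕ → Carrier
  pow x zero = 1#
  pow x (suc n) = x * pow x n

  nat : ℕ → Carrier
  nat zero = 0#
  nat (suc n) = 1# + nat n

  sumTo : ℕ → (ℕ → Carrier) → Carrier
  sumTo zero f = f zero
  sumTo (suc n) f = sumTo n f + f (suc n)

  prodBelow : ℕ → (ℕ → Carrier) → Carrier
  prodBelow zero f = 1#
  prodBelow (suc n) f = prodBelow n f * f n

  eval3 : Poly3 → Carrier → Carrier → Carrier → Carrier
  eval3 [] x y b = 0#
  eval3 ((c , i , j , k) ∷ ms) x y b =
    nat c * pow x i * pow y j * pow b k + eval3 ms x y b

  poch : Carrier → Carrier → ℕ → Carrier
  poch a p n = prodBelow n (λ i → 1# - a * pow p i)

  Series : Set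
  Series = ℕ → Carrier

  _≈ₛ_ : Series → Series → Set
  f ≈ₛ g = ∀ n → f n ≈ g n

  _*ₛ_ : Series → Series → Series
  (f *ₛ g) n = sumTo n (λ i → f i * g (n ∸ i))

  constₛ : Carrier → Series
  constₛ c zero = c
  constₛ c (suc n) = 0#

  zₛ : Series → Series
  zₛ f zero = 0#
  zₛ f (suc n) = f n

  evenₛ : (ℕ → Carrier) → Series
  evenₛ c zero = c zero
  evenₛ c (suc zero) = 0#
  evenₛ c (suc (suc m)) = evenₛ (λ n → c (suc n)) m

  -- Σ_{n≥1} c n z^(2n-1)
  oddₛ : (ℕ → Carrier) → Series
  oddₛ c zero = 0#
  oddₛ c (suc m) = evenₛ (λ n → c (suc n)) m

  _+ₛ_ : Series → Series → Series
  (f +ₛ g) n = f n + g n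

  -- Φ_ν(w z ; p) as a power series in z, for base p with s = p^ν.
  -- The coefficient of (p w^2 z^2)^n is (-1)^n p^(n choose 2) / ((p;p)_n (p^(ν+1);p)_n);
  -- cinv n is (a given) inverse of (p;p)_n (s p ; p)_n.
  Φₛ : (p w : Carrier) → (cinv : ℕ → Carrier) → Series
  Φₛ p w cinv = evenₛ (λ n →
    pow (- 1#) n * pow p (n C 2) * pow (p * (w * w)) n * cinv n)

  PhiInv : (p s : Carrier) → (ℕ → Carrier) → Set
  PhiInv p s cinv = ∀ n → (poch p p n * poch (s * p) p n) * cinv n ≈ 1#

  -- The statement "J_{ν+1}(w z;p) / J_ν(w z;p) = S(z)" as formal power series in z,
  -- where e = 1/(1 - p^(ν+1)), c0 / c1 invert the denominators of
  -- Φ_ν(·;p) / Φ_{ν+1}(·;p).  Since J_{ν+1}/J_ν = w z/(1-p^(ν+1)) · Φ_{ν+1}/Φ_ν and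
  -- Φ_ν has constant term 1 (a unit), this says  (e w z) Φ_{ν+1} = S Φ_ν.
  BesselRatioIs : (p w e : Carrier) → (c0 c1 : ℕ → Carrier) → Series → Set
  BesselRatioIs p w e c0 c1 S =
    zₛ (constₛ (e * w) *ₛ Φₛ p w c1) ≈ₛ (S *ₛ Φₛ p w c0)

  -- [k+ν]_q = (1 - q^k q^ν)/(1 - q), with ui the inverse of 1 - q, t = q^ν
  qnum+ν : (q t ui : Carrier) → ℕ → Carrier
  qnum+ν q t ui k = (1# - pow q k * t) * ui

  D : (q t ui : Carrier) → ℕ → Carrier
  D q t ui n = prodBelow n (λ j → pow (qnum+ν q t ui (suc j)) (n / suc j))

module Submission where

-- Write J_{ν+1}/J_ν = w z/(1-p^{ν+1}) · Φ_{ν+1}/Φ_ν and put u = z².  Comparing coefficients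
-- gives the contiguity relations Φ_ν(u) = e (Φ_{ν+1}(u) - p^{ν+1} Φ_{ν+1}(pu)) and
-- Φ_ν(u) - Φ_ν(pu) = -p w² u e Φ_{ν+1}(pu), with e = 1/(1-p^{ν+1}).  Hence any P with
--   P(u) - 1 - p^{ν+1} P(pu) = p w² u (P(u) - 1) P(pu)
-- satisfies P Φ_ν = e Φ_{ν+1}: the difference E = P Φ_ν - e Φ_{ν+1} obeys a linear equation
-- whose u^n coefficient is (1 - p^{ν+1+n}) E_n = (terms in E_j, j < n), and each 1 - p^{ν+1+n}
-- is a unit.  For both bases such a P comes from β_n = N_{n+1}/D_{n+1}, namely
-- P = 1 + q^{ν+1}/(1-q) β(qu) for base q and P = -q^{ν+1}/(1-q) β(q^{ν+1}u) for base q⁻¹, provided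
--   [1+ν] β_0 = 1,   [n+2+ν] β_{n+1} = (1-q) β_n + q^{ν+1} Σ_{i≤n} q^{n-i} β_i β_{n-i}.
-- Since [1+ν] β_0 = 1, the terms (1-q) β_n + q^{ν+1} β_n β_0 combine to β_0 β_n, so the recurrence
-- has nonnegative coefficients; multiplying it by D_{n+2} keeps them polynomial because
-- D_a D_c [a+c+ν] divides D_{a+c}, as ⌊a/k⌋ + ⌊c/k⌋ ≤ ⌊(a+c)/k⌋.

open import Defs
open import Level using (0ℓ)
open import Algebra.Bundles using (CommutativeRing)
import Algebra.Solver.Ring.AlmostCommutativeRing as ACR
open import Data.Nat as ℕ using (ℕ; zero; suc; _∸_; _≤_; _<_; _≤?_; z≤n; s≤s)
import Data.Nat.Properties as ℕP
open import Data.Nat.DivMod using (_/_; m*n/n≡m; /-monoˡ-≤; m/n*n≤m; m<n⇒m/n≡0; n/n≡1)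
open import Data.Nat.Induction using (<-rec)
open import Data.Nat.Combinatorics using (_C_; nC1≡n; nCk+nC[k+1]≡[n+1]C[k+1])
open import Data.Integer as ℤ using (ℤ; +_; -[1+_]; _⊖_)
import Data.Integer.Properties as ℤP
open import Data.Sign as Sign using (Sign)
open import Data.Maybe as Maybe using (Maybe)
open import Data.List using ([]; _∷_; _++_; map)
open import Data.Product using (Σ; _×_; _,_; proj₂)
open import Data.Sum using (inj₁; inj₂)
open import Relation.Nullary using (yes; no; contradiction; dec⇒maybe)
open import Relation.Binary.Bundles using (Setoid)
open import Relation.Binary.PropositionalEquality as ≡ using (_≡_)

module IntegerCoefficientSolver (R : CommutativeRing 0ℓ 0ℓ) where
  open CommutativeRing R hiding (zero)
  open Q R
  open import Algebra.Properties.Ring ring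
    using (-‿involutive; -‿distribˡ-*; -‿distribʳ-*; -‿+-comm; -0#≈0#)
  open import Algebra.Properties.CommutativeSemigroup *-commutativeSemigroup
    using (interchange)
  open import Relation.Binary.Reasoning.Setoid setoid

  nat-+ : ∀ m n → nat (m ℕ.+ n) ≈ nat m + nat n
  nat-+ zero    n = sym (+-identityˡ _)
  nat-+ (suc m) n = trans (+-congˡ (nat-+ m n)) (sym (+-assoc _ _ _))

  nat-* : ∀ m n → nat (m ℕ.* n) ≈ nat m * nat n
  nat-* zero    n = sym (zeroˡ _)
  nat-* (suc m) n = begin
    nat (n ℕ.+ m ℕ.* n)        ≈⟨ nat-+ n (m ℕ.* n) ⟩
    nat n + nat (m ℕ.* n)      ≈⟨ +-cong (sym (*-identityˡ _)) (nat-* m n) ⟩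
    1# * nat n + nat m * nat n ≈⟨ distribʳ _ _ _ ⟨
    (1# + nat m) * nat n       ∎

  -- The clause for 1 makes the solver's constant 1 evaluate to 1# on the nose.
  int : ℤ → Carrier
  int (+ 1)    = 1#
  int (+ n)    = nat n
  int -[1+ n ] = - nat (suc n)

  int-nat : ∀ n → int (+ n) ≈ nat n
  int-nat zero          = refl
  int-nat (suc zero)    = sym (+-identityʳ 1#)
  int-nat (suc (suc n)) = refl

  sign : Sign → Carrier
  sign Sign.+ = 1#
  sign Sign.- = - 1#

  sign-* : ∀ s r → sign (s Sign.* r) ≈ sign s * sign r
  sign-* Sign.+ r      = sym (*-identityˡ _)
  sign-* Sign.- Sign.+ = sym (*-identityʳ _)
  sign-* Sign.- Sign.- = begin
    1#            ≈⟨ -‿involutive 1# ⟨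
    - (- 1#)      ≈⟨ -‿cong (*-identityʳ _) ⟨
    - (- 1# * 1#) ≈⟨ -‿distribʳ-* _ _ ⟩
    - 1# * - 1#   ∎

  int-◃ : ∀ s n → int (s ℤ.◃ n) ≈ sign s * nat n
  int-◃ s      zero    = sym (zeroʳ _)
  int-◃ Sign.+ (suc n) = trans (int-nat (suc n)) (sym (*-identityˡ _))
  int-◃ Sign.- (suc n) = trans (-‿cong (sym (*-identityˡ _))) (-‿distribˡ-* _ _)

  int-signAbs : ∀ i → int i ≈ sign (ℤ.sign i) * nat ℤ.∣ i ∣
  int-signAbs i = ≡.subst (λ j → int j ≈ sign (ℤ.sign i) * nat ℤ.∣ i ∣) (ℤP.◃-inverse i) (int-◃ (ℤ.sign i) ℤ.∣ i ∣)

  int-⊖ : ∀ m n → int (m ⊖ n) ≈ nat m - nat n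
  int-⊖ m zero = begin
    int (m ⊖ 0)  ≡⟨ ≡.cong int (ℤP.⊖-≥ {m} ℕ.z≤n) ⟩
    int (+ m)    ≈⟨ int-nat m ⟩
    nat m        ≈⟨ +-identityʳ _ ⟨
    nat m + 0#   ≈⟨ +-congˡ -0#≈0# ⟨
    nat m - 0#   ∎
  int-⊖ zero (suc n) = begin
    int (0 ⊖ suc n)  ≡⟨ ≡.cong int (ℤP.⊖-≤ {0} {suc n} ℕ.z≤n) ⟩
    - nat (suc n)    ≈⟨ +-identityˡ _ ⟨
    0# - nat (suc n) ∎
  int-⊖ (suc m) (suc n) = begin
    int (suc m ⊖ suc n)         ≡⟨ ≡.cong int (ℤP.[1+m]⊖[1+n]≡m⊖n m n) ⟩
    int (m ⊖ n)                 ≈⟨ int-⊖ m n ⟩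
    nat m - nat n               ≈⟨ +-identityˡ _ ⟨
    0# + (nat m - nat n)        ≈⟨ +-congʳ (-‿inverseʳ 1#) ⟨
    (1# - 1#) + (nat m - nat n) ≈⟨ +-assoc _ _ _ ⟩
    1# + (- 1# + (nat m - nat n)) ≈⟨ +-congˡ (sym (+-assoc _ _ _)) ⟩
    1# + ((- 1# + nat m) - nat n) ≈⟨ +-congˡ (+-congʳ (+-comm _ _)) ⟩
    1# + ((nat m - 1#) - nat n)   ≈⟨ +-congˡ (+-assoc _ _ _) ⟩
    1# + (nat m + (- 1# - nat n)) ≈⟨ +-assoc _ _ _ ⟨
    nat (suc m) + (- 1# - nat n)  ≈⟨ +-congˡ (-‿+-comm 1# (nat n)) ⟩
    nat (suc m) - nat (suc n)     ∎

  int-+ : ∀ i j → int (i ℤ.+ j) ≈ int i + int j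
  int-+ (+ m)    (+ n)    = trans (int-nat (m ℕ.+ n))
    (trans (nat-+ m n) (sym (+-cong (int-nat m) (int-nat n))))
  int-+ (+ m)    -[1+ n ] = trans (int-⊖ m (suc n)) (+-congʳ (sym (int-nat m)))
  int-+ -[1+ m ] (+ n)    = trans (int-⊖ n (suc m)) (trans (+-comm _ _) (+-congˡ (sym (int-nat n))))
  int-+ -[1+ m ] -[1+ n ] = begin
    - (1# + nat (suc m ℕ.+ n))        ≈⟨ -‿cong (+-congˡ (nat-+ (suc m) n)) ⟩
    - (1# + (nat (suc m) + nat n))    ≈⟨ -‿cong (trans (sym (+-assoc _ _ _)) (trans (+-congʳ (+-comm _ _)) (+-assoc _ _ _))) ⟩
    - (nat (suc m) + nat (suc n))     ≈⟨ -‿+-comm _ _ ⟨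
    - nat (suc m) + - nat (suc n)     ∎

  int-* : ∀ i j → int (i ℤ.* j) ≈ int i * int j
  int-* i j = begin
    int (ℤ.sign i Sign.* ℤ.sign j ℤ.◃ ℤ.∣ i ∣ ℕ.* ℤ.∣ j ∣)
      ≈⟨ int-◃ (ℤ.sign i Sign.* ℤ.sign j) (ℤ.∣ i ∣ ℕ.* ℤ.∣ j ∣) ⟩
    sign (ℤ.sign i Sign.* ℤ.sign j) * nat (ℤ.∣ i ∣ ℕ.* ℤ.∣ j ∣)
      ≈⟨ *-cong (sign-* (ℤ.sign i) (ℤ.sign j)) (nat-* ℤ.∣ i ∣ ℤ.∣ j ∣) ⟩
    (sign (ℤ.sign i) * sign (ℤ.sign j)) * (nat ℤ.∣ i ∣ * nat ℤ.∣ j ∣)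
      ≈⟨ interchange _ _ _ _ ⟩
    (sign (ℤ.sign i) * nat ℤ.∣ i ∣) * (sign (ℤ.sign j) * nat ℤ.∣ j ∣)
      ≈⟨ *-cong (int-signAbs i) (int-signAbs j) ⟨
    int i * int j ∎

  int-neg : ∀ i → int (ℤ.- i) ≈ - int i
  int-neg -[1+ n ]   = trans (int-nat (suc n)) (sym (-‿involutive _))
  int-neg (+ zero)   = sym -0#≈0#
  int-neg (+ suc n)  = -‿cong (sym (int-nat (suc n)))

  int-homomorphism : ℤ.+-*-rawRing ACR.-Raw-AlmostCommutative⟶ ACR.fromCommutativeRing R
  int-homomorphism = record
    { ⟦_⟧ = int ; +-homo = int-+ ; *-homo = int-* ; -‿homo = int-neg
    ; 0-homo = refl ; 1-homo = refl }

  int-≟ : ∀ i j → Maybe (int i ≈ int j)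
  int-≟ i j = Maybe.map (λ i≡j → reflexive (≡.cong int i≡j)) (dec⇒maybe (i ℤP.≟ j))

  open import Algebra.Solver.Ring ℤ.+-*-rawRing (ACR.fromCommutativeRing R) int-homomorphism int-≟
    public using (solve; Polynomial; _:=_; _:+_; _:*_; _:-_; :-_; con)

  :0 :1 : ∀ {n} → Polynomial n
  :0 = con (ℤ.+ 0)
  :1 = con (ℤ.+ 1)

module RingLemmas (R : CommutativeRing 0ℓ 0ℓ) where
  open CommutativeRing R hiding (zero)
  open Q R
  open IntegerCoefficientSolver R
  open import Relation.Binary.Reasoning.Setoid setoid

  pow-cong : ∀ {x y} n → x ≈ y → pow x n ≈ pow y n
  pow-cong zero    x≈y = refl
  pow-cong (suc n) x≈y = *-cong x≈y (pow-cong n x≈y)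

  pow-+ : ∀ x m n → pow x (m ℕ.+ n) ≈ pow x m * pow x n
  pow-+ x zero    n = sym (*-identityˡ _)
  pow-+ x (suc m) n = trans (*-congˡ (pow-+ x m n)) (sym (*-assoc _ _ _))

  pow-∸ : ∀ x {m n} → m ≤ n → pow x m * pow x (n ∸ m) ≈ pow x n
  pow-∸ x {m} {n} m≤n =
    trans (sym (pow-+ x m (n ∸ m))) (reflexive (≡.cong (pow x) (ℕP.m+[n∸m]≡n m≤n)))

  pow-* : ∀ x y n → pow (x * y) n ≈ pow x n * pow y n
  pow-* x y zero    = sym (*-identityˡ _)
  pow-* x y (suc n) = trans (*-congˡ (pow-* x y n))
    (solve 4 (λ a b c d → (a :* b) :* (c :* d) := (a :* c) :* (b :* d)) refl _ _ _ _)

  pow-inverse : ∀ {x y} → x * y ≈ 1# → ∀ n → pow x n * pow y n ≈ 1#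
  pow-inverse {x} {y} xy≈1 zero    = *-identityˡ 1#
  pow-inverse {x} {y} xy≈1 (suc n) = begin
    (x * pow x n) * (y * pow y n) ≈⟨ solve 4 (λ a b c d → (a :* b) :* (c :* d) := (a :* c) :* (b :* d)) refl _ _ _ _ ⟩
    (x * y) * (pow x n * pow y n) ≈⟨ *-cong xy≈1 (pow-inverse xy≈1 n) ⟩
    1# * 1#                       ≈⟨ *-identityˡ 1# ⟩
    1#                            ∎

  inverse-unique : ∀ {a x y} → a * x ≈ 1# → a * y ≈ 1# → x ≈ y
  inverse-unique {a} {x} {y} ax≈1 ay≈1 = begin
    x             ≈⟨ *-identityˡ x ⟨
    1# * x        ≈⟨ *-congʳ ay≈1 ⟨
    (a * y) * x   ≈⟨ solve 3 (λ a x y → (a :* y) :* x := (a :* x) :* y) refl a x y ⟩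
    (a * x) * y   ≈⟨ *-congʳ ax≈1 ⟩
    1# * y        ≈⟨ *-identityˡ y ⟩
    y             ∎

  unit-cancel-zero : ∀ {a b x} → a * b ≈ 1# → a * x ≈ 0# → x ≈ 0#
  unit-cancel-zero {a} {b} {x} ab≈1 ax≈0 = begin
    x             ≈⟨ *-identityˡ x ⟨
    1# * x        ≈⟨ *-congʳ ab≈1 ⟨
    (a * b) * x   ≈⟨ solve 3 (λ a b x → (a :* b) :* x := b :* (a :* x)) refl a b x ⟩
    b * (a * x)   ≈⟨ *-congˡ ax≈0 ⟩
    b * 0#        ≈⟨ zeroʳ b ⟩
    0#            ∎

  sumTo-cong : ∀ n {f g} → (∀ i → i ≤ n → f i ≈ g i) → sumTo n f ≈ sumTo n g
  sumTo-cong zero    f≈g = f≈g 0 z≤n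
  sumTo-cong (suc n) f≈g =
    +-cong (sumTo-cong n (λ i i≤n → f≈g i (ℕP.m≤n⇒m≤1+n i≤n))) (f≈g (suc n) ℕP.≤-refl)

  sumTo-zero : ∀ n f → (∀ i → i ≤ n → f i ≈ 0#) → sumTo n f ≈ 0#
  sumTo-zero zero    f f≈0 = f≈0 0 z≤n
  sumTo-zero (suc n) f f≈0 =
    trans (+-cong (sumTo-zero n f (λ i i≤n → f≈0 i (ℕP.m≤n⇒m≤1+n i≤n))) (f≈0 (suc n) ℕP.≤-refl))
          (+-identityʳ 0#)

  sumTo-+ : ∀ n f g → sumTo n (λ i → f i + g i) ≈ sumTo n f + sumTo n g
  sumTo-+ zero    f g = refl
  sumTo-+ (suc n) f g = trans (+-congʳ (sumTo-+ n f g))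
    (solve 4 (λ a b c d → (a :+ b) :+ (c :+ d) := (a :+ c) :+ (b :+ d)) refl _ _ _ _)

  sumTo-neg : ∀ n f → sumTo n (λ i → - f i) ≈ - sumTo n f
  sumTo-neg zero    f = refl
  sumTo-neg (suc n) f = trans (+-congʳ (sumTo-neg n f))
    (solve 2 (λ a b → (:- a) :+ (:- b) := :- (a :+ b)) refl _ _)

  sumTo-*ˡ : ∀ n c f → c * sumTo n f ≈ sumTo n (λ i → c * f i)
  sumTo-*ˡ zero    c f = refl
  sumTo-*ˡ (suc n) c f = trans (distribˡ _ _ _) (+-congʳ (sumTo-*ˡ n c f))

  sumTo-suc : ∀ n f → sumTo (suc n) f ≈ f 0 + sumTo n (λ i → f (suc i))
  sumTo-suc zero    f = refl
  sumTo-suc (suc n) f = trans (+-congʳ (sumTo-suc n f)) (+-assoc _ _ _)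

  sumBelow : ℕ → (ℕ → Carrier) → Carrier
  sumBelow zero    f = 0#
  sumBelow (suc k) f = sumBelow k f + f k

  sumBelow-cong : ∀ k {f g} → (∀ i → i < k → f i ≈ g i) → sumBelow k f ≈ sumBelow k g
  sumBelow-cong zero    f≈g = refl
  sumBelow-cong (suc k) f≈g =
    +-cong (sumBelow-cong k (λ i i<k → f≈g i (ℕP.m≤n⇒m≤1+n i<k))) (f≈g k ℕP.≤-refl)

  sumBelow-*ˡ : ∀ k c f → c * sumBelow k f ≈ sumBelow k (λ i → c * f i)
  sumBelow-*ˡ zero    c f = zeroʳ c
  sumBelow-*ˡ (suc k) c f = trans (distribˡ _ _ _) (+-congʳ (sumBelow-*ˡ k c f))

  sumTo≈sumBelow : ∀ k f → sumTo k f ≈ sumBelow k f + f k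
  sumTo≈sumBelow zero    f = sym (+-identityˡ _)
  sumTo≈sumBelow (suc k) f = +-congʳ (sumTo≈sumBelow k f)

  prodBelow-cong : ∀ n {f g} → (∀ j → j < n → f j ≈ g j) → prodBelow n f ≈ prodBelow n g
  prodBelow-cong zero    f≈g = refl
  prodBelow-cong (suc n) f≈g =
    *-cong (prodBelow-cong n (λ j j<n → f≈g j (ℕP.m≤n⇒m≤1+n j<n))) (f≈g n ℕP.≤-refl)

  prodBelow-* : ∀ n f g → prodBelow n (λ j → f j * g j) ≈ prodBelow n f * prodBelow n g
  prodBelow-* zero    f g = sym (*-identityˡ 1#)
  prodBelow-* (suc n) f g = trans (*-congʳ (prodBelow-* n f g))
    (solve 4 (λ a b c d → (a :* b) :* (c :* d) := (a :* c) :* (b :* d)) refl _ _ _ _)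

  prodBelow-ones : ∀ {m} n f → m ≤ n → (∀ j → m ≤ j → j < n → f j ≈ 1#) →
                   prodBelow n f ≈ prodBelow m f
  prodBelow-ones zero    f z≤n  _   = refl
  prodBelow-ones (suc n) f m≤1+n f≈1 with ℕP.m≤n⇒m<n∨m≡n m≤1+n
  ... | inj₂ ≡.refl     = refl
  ... | inj₁ (s≤s m≤n) = trans
    (*-cong (prodBelow-ones n f m≤n (λ j m≤j j<n → f≈1 j m≤j (ℕP.m≤n⇒m≤1+n j<n)))
            (f≈1 n m≤n ℕP.≤-refl))
    (*-identityʳ _)

  poch-suc : ∀ a p n → poch a p (suc n) ≈ (1# - a) * poch (a * p) p n
  poch-suc a p zero    = solve 1 (λ a → :1 :* (:1 :- a :* :1) := (:1 :- a) :* :1) refl a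
  poch-suc a p (suc n) = begin
    poch a p (suc n) * (1# - a * (p * pow p n))           ≈⟨ *-cong (poch-suc a p n) (+-congˡ (-‿cong (sym (*-assoc _ _ _)))) ⟩
    ((1# - a) * poch (a * p) p n) * (1# - a * p * pow p n) ≈⟨ *-assoc _ _ _ ⟩
    (1# - a) * poch (a * p) p (suc n)                       ∎

module PowerSeries (R : CommutativeRing 0ℓ 0ℓ) where
  open CommutativeRing R hiding (zero)
  open Q R
  open IntegerCoefficientSolver R
  open RingLemmas R
  open import Relation.Binary.Reasoning.Setoid setoid

  infixr 30 _·ₛ_

  _·ₛ_ : Carrier → Series → Series
  (c ·ₛ f) n = c * f n

  _-ₛ_ : Series → Series → Series
  (f -ₛ g) n = f n - g n

  dilₛ : Carrier → Series → Series
  dilₛ p f n = pow p n * f n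

  tailₛ : Series → Series
  tailₛ f n = f (suc n)

  seriesSetoid : Setoid 0ℓ 0ℓ
  seriesSetoid = record
    { Carrier = Series
    ; _≈_ = _≈ₛ_
    ; isEquivalence = record
      { refl = λ n → refl ; sym = λ f≈g n → sym (f≈g n) ; trans = λ f≈g g≈h n → trans (f≈g n) (g≈h n) }
    }

  open Setoid seriesSetoid public using () renaming (refl to ≈ₛ-refl; sym to ≈ₛ-sym; trans to ≈ₛ-trans)

  zₛ-cong : ∀ {f g} → f ≈ₛ g → zₛ f ≈ₛ zₛ g
  zₛ-cong f≈g zero    = refl
  zₛ-cong f≈g (suc n) = f≈g n

  zₛ--ₛ : ∀ f g → zₛ (f -ₛ g) ≈ₛ (zₛ f -ₛ zₛ g)
  zₛ--ₛ f g zero    = solve 0 (:0 := :0 :- :0) refl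
  zₛ--ₛ f g (suc n) = refl

  *ₛ-suc : ∀ f g n → (f *ₛ g) (suc n) ≈ f 0 * g (suc n) + (tailₛ f *ₛ g) n
  *ₛ-suc f g n = sumTo-suc n (λ i → f i * g (suc n ∸ i))

  *ₛ-congˡ : ∀ {f f′} g → f ≈ₛ f′ → (f *ₛ g) ≈ₛ (f′ *ₛ g)
  *ₛ-congˡ g f≈f′ n = sumTo-cong n (λ i _ → *-congʳ (f≈f′ i))

  *ₛ-congʳ : ∀ f {g g′} → g ≈ₛ g′ → (f *ₛ g) ≈ₛ (f *ₛ g′)
  *ₛ-congʳ f g≈g′ n = sumTo-cong n (λ i _ → *-congˡ (g≈g′ (n ∸ i)))

  *ₛ-cong : ∀ {f f′ g g′} → f ≈ₛ f′ → g ≈ₛ g′ → (f *ₛ g) ≈ₛ (f′ *ₛ g′)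
  *ₛ-cong {f′ = f′} {g = g} f≈f′ g≈g′ = ≈ₛ-trans (*ₛ-congˡ g f≈f′) (*ₛ-congʳ f′ g≈g′)

  *ₛ-distribʳ-+ₛ : ∀ f g h → ((f +ₛ g) *ₛ h) ≈ₛ ((f *ₛ h) +ₛ (g *ₛ h))
  *ₛ-distribʳ-+ₛ f g h n = trans (sumTo-cong n (λ i _ → distribʳ _ _ _)) (sumTo-+ n _ _)

  *ₛ-distribʳ--ₛ : ∀ f g h → ((f -ₛ g) *ₛ h) ≈ₛ ((f *ₛ h) -ₛ (g *ₛ h))
  *ₛ-distribʳ--ₛ f g h n = begin
    sumTo n (λ i → (f i - g i) * h (n ∸ i))                ≈⟨ sumTo-cong n (λ i _ → solve 3 (λ a b c → (a :- b) :* c := a :* c :+ :- (b :* c)) refl _ _ _) ⟩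
    sumTo n (λ i → f i * h (n ∸ i) + - (g i * h (n ∸ i))) ≈⟨ sumTo-+ n _ _ ⟩
    (f *ₛ h) n + sumTo n (λ i → - (g i * h (n ∸ i)))      ≈⟨ +-congˡ (sumTo-neg n _) ⟩
    (f *ₛ h) n - (g *ₛ h) n                                ∎

  ·ₛ-*ₛ : ∀ c f g → (c ·ₛ f *ₛ g) ≈ₛ c ·ₛ (f *ₛ g)
  ·ₛ-*ₛ c f g n = trans (sumTo-cong n (λ i _ → *-assoc _ _ _)) (sym (sumTo-*ˡ n c _))

  constₛ-*ₛ : ∀ c g → (constₛ c *ₛ g) ≈ₛ c ·ₛ g
  constₛ-*ₛ c g zero    = refl
  constₛ-*ₛ c g (suc n) = begin
    (constₛ c *ₛ g) (suc n)                    ≈⟨ *ₛ-suc (constₛ c) g n ⟩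
    c * g (suc n) + (tailₛ (constₛ c) *ₛ g) n ≈⟨ +-congˡ (sumTo-zero n _ (λ i _ → zeroˡ _)) ⟩
    c * g (suc n) + 0#                         ≈⟨ +-identityʳ _ ⟩
    c * g (suc n)                              ∎

  *ₛ-identityˡ : ∀ g → (constₛ 1# *ₛ g) ≈ₛ g
  *ₛ-identityˡ g n = trans (constₛ-*ₛ 1# g n) (*-identityˡ _)

  zₛ-*ₛ : ∀ f g → (zₛ f *ₛ g) ≈ₛ zₛ (f *ₛ g)
  zₛ-*ₛ f g zero    = zeroˡ _
  zₛ-*ₛ f g (suc n) = trans (*ₛ-suc (zₛ f) g n) (trans (+-congʳ (zeroˡ _)) (+-identityˡ _))

  tailₛ-*ₛ : ∀ f g → tailₛ (f *ₛ g) ≈ₛ (f 0 ·ₛ tailₛ g +ₛ (tailₛ f *ₛ g))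
  tailₛ-*ₛ f g = *ₛ-suc f g

  private
    *ₛ-comm-at : ∀ n f g → (f *ₛ g) n ≈ (g *ₛ f) n
    *ₛ-comm-at zero          f g = *-comm _ _
    *ₛ-comm-at (suc zero)    f g = begin
      (f *ₛ g) 1              ≈⟨ *ₛ-suc f g 0 ⟩
      f 0 * g 1 + f 1 * g 0   ≈⟨ solve 4 (λ a b c d → a :* b :+ c :* d := d :* c :+ b :* a) refl _ _ _ _ ⟩
      g 0 * f 1 + g 1 * f 0   ≈⟨ *ₛ-suc g f 0 ⟨
      (g *ₛ f) 1              ∎
    *ₛ-comm-at (suc (suc m)) f g = begin
      (f *ₛ g) (suc (suc m))
        ≈⟨ trans (*ₛ-suc f g (suc m)) (+-congˡ (*ₛ-comm-at (suc m) (tailₛ f) g)) ⟩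
      f 0 * g (2 ℕ.+ m) + (g *ₛ tailₛ f) (suc m)
        ≈⟨ +-congˡ (trans (*ₛ-suc g (tailₛ f) m) (+-congˡ (*ₛ-comm-at m (tailₛ g) (tailₛ f)))) ⟩
      f 0 * g (2 ℕ.+ m) + (g 0 * f (2 ℕ.+ m) + (tailₛ f *ₛ tailₛ g) m)
        ≈⟨ solve 3 (λ a b c → a :+ (b :+ c) := b :+ (a :+ c)) refl _ _ _ ⟩
      g 0 * f (2 ℕ.+ m) + (f 0 * g (2 ℕ.+ m) + (tailₛ f *ₛ tailₛ g) m)
        ≈⟨ +-congˡ (trans (sym (*ₛ-suc f (tailₛ g) m)) (*ₛ-comm-at (suc m) f (tailₛ g))) ⟩
      g 0 * f (2 ℕ.+ m) + (tailₛ g *ₛ f) (suc m)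
        ≈⟨ *ₛ-suc g f (suc m) ⟨
      (g *ₛ f) (suc (suc m)) ∎

    *ₛ-assoc-at : ∀ n f g h → ((f *ₛ g) *ₛ h) n ≈ (f *ₛ (g *ₛ h)) n
    *ₛ-assoc-at zero    f g h = *-assoc _ _ _
    *ₛ-assoc-at (suc n) f g h = begin
      ((f *ₛ g) *ₛ h) (suc n)
        ≈⟨ *ₛ-suc (f *ₛ g) h n ⟩
      (f 0 * g 0) * h (suc n) + (tailₛ (f *ₛ g) *ₛ h) n
        ≈⟨ +-congˡ (trans (*ₛ-congˡ h (tailₛ-*ₛ f g) n) (*ₛ-distribʳ-+ₛ _ _ h n)) ⟩
      (f 0 * g 0) * h (suc n) + ((f 0 ·ₛ tailₛ g *ₛ h) n + ((tailₛ f *ₛ g) *ₛ h) n)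
        ≈⟨ +-congˡ (+-cong (·ₛ-*ₛ (f 0) (tailₛ g) h n) (*ₛ-assoc-at n (tailₛ f) g h)) ⟩
      (f 0 * g 0) * h (suc n) + (f 0 * (tailₛ g *ₛ h) n + (tailₛ f *ₛ (g *ₛ h)) n)
        ≈⟨ solve 5 (λ a b c d e → (a :* b) :* c :+ (a :* d :+ e) := a :* (b :* c :+ d) :+ e) refl _ _ _ _ _ ⟩
      f 0 * (g 0 * h (suc n) + (tailₛ g *ₛ h) n) + (tailₛ f *ₛ (g *ₛ h)) n
        ≈⟨ +-congʳ (*-congˡ (*ₛ-suc g h n)) ⟨
      f 0 * (g *ₛ h) (suc n) + (tailₛ f *ₛ (g *ₛ h)) n
        ≈⟨ *ₛ-suc f (g *ₛ h) n ⟨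
      (f *ₛ (g *ₛ h)) (suc n) ∎

    dilₛ-*ₛ-at : ∀ n p f g → dilₛ p (f *ₛ g) n ≈ (dilₛ p f *ₛ dilₛ p g) n
    dilₛ-*ₛ-at zero    p f g = solve 2 (λ a b → :1 :* (a :* b) := (:1 :* a) :* (:1 :* b)) refl (f 0) (g 0)
    dilₛ-*ₛ-at (suc n) p f g = begin
      pow p (suc n) * (f *ₛ g) (suc n)
        ≈⟨ *-congˡ (*ₛ-suc f g n) ⟩
      (p * pow p n) * (f 0 * g (suc n) + (tailₛ f *ₛ g) n)
        ≈⟨ solve 5 (λ p q a b c → (p :* q) :* (a :* b :+ c) := (:1 :* a) :* ((p :* q) :* b) :+ p :* (q :* c)) refl p (pow p n) (f 0) (g (suc n)) ((tailₛ f *ₛ g) n) ⟩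
      (1# * f 0) * dilₛ p g (suc n) + p * dilₛ p (tailₛ f *ₛ g) n
        ≈⟨ +-congˡ (*-congˡ (dilₛ-*ₛ-at n p (tailₛ f) g)) ⟩
      (1# * f 0) * dilₛ p g (suc n) + p * (dilₛ p (tailₛ f) *ₛ dilₛ p g) n
        ≈⟨ +-congˡ (·ₛ-*ₛ p (dilₛ p (tailₛ f)) (dilₛ p g) n) ⟨
      (1# * f 0) * dilₛ p g (suc n) + (p ·ₛ dilₛ p (tailₛ f) *ₛ dilₛ p g) n
        ≈⟨ +-congˡ (*ₛ-congˡ (dilₛ p g) (λ i → sym (*-assoc _ _ _)) n) ⟩
      (1# * f 0) * dilₛ p g (suc n) + (tailₛ (dilₛ p f) *ₛ dilₛ p g) n
        ≈⟨ *ₛ-suc (dilₛ p f) (dilₛ p g) n ⟨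
      (dilₛ p f *ₛ dilₛ p g) (suc n) ∎

  *ₛ-comm : ∀ f g → (f *ₛ g) ≈ₛ (g *ₛ f)
  *ₛ-comm f g n = *ₛ-comm-at n f g

  *ₛ-assoc : ∀ f g h → ((f *ₛ g) *ₛ h) ≈ₛ (f *ₛ (g *ₛ h))
  *ₛ-assoc f g h n = *ₛ-assoc-at n f g h

  dilₛ-*ₛ : ∀ p f g → dilₛ p (f *ₛ g) ≈ₛ (dilₛ p f *ₛ dilₛ p g)
  dilₛ-*ₛ p f g n = dilₛ-*ₛ-at n p f g

  dilₛ-cong : ∀ p {f g} → f ≈ₛ g → dilₛ p f ≈ₛ dilₛ p g
  dilₛ-cong p f≈g n = *-congˡ (f≈g n)

  *ₛ-distribˡ-+ₛ : ∀ f g h → (h *ₛ (f +ₛ g)) ≈ₛ ((h *ₛ f) +ₛ (h *ₛ g))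
  *ₛ-distribˡ-+ₛ f g h n = trans (*ₛ-comm h (f +ₛ g) n)
    (trans (*ₛ-distribʳ-+ₛ f g h n) (+-cong (*ₛ-comm f h n) (*ₛ-comm g h n)))

  *ₛ-distribˡ--ₛ : ∀ f g h → (h *ₛ (f -ₛ g)) ≈ₛ ((h *ₛ f) -ₛ (h *ₛ g))
  *ₛ-distribˡ--ₛ f g h n = trans (*ₛ-comm h (f -ₛ g) n)
    (trans (*ₛ-distribʳ--ₛ f g h n) (+-cong (*ₛ-comm f h n) (-‿cong (*ₛ-comm g h n))))

  *ₛ-·ₛ : ∀ c f g → (f *ₛ c ·ₛ g) ≈ₛ c ·ₛ (f *ₛ g)
  *ₛ-·ₛ c f g n = trans (*ₛ-comm f (c ·ₛ g) n) (trans (·ₛ-*ₛ c g f n) (*-congˡ (*ₛ-comm g f n)))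

  *ₛ-zₛ : ∀ f g → (f *ₛ zₛ g) ≈ₛ zₛ (f *ₛ g)
  *ₛ-zₛ f g n = trans (*ₛ-comm f (zₛ g) n) (trans (zₛ-*ₛ g f n) (zₛ-cong (*ₛ-comm g f) n))

module EvenSeries (R : CommutativeRing 0ℓ 0ℓ) where
  open CommutativeRing R hiding (zero)
  open Q R
  open PowerSeries R
  open import Relation.Binary.Reasoning.Setoid setoid

  evenₛ-cong : ∀ {a b} → a ≈ₛ b → evenₛ a ≈ₛ evenₛ b
  evenₛ-cong a≈b zero          = a≈b 0
  evenₛ-cong a≈b (suc zero)    = refl
  evenₛ-cong a≈b (suc (suc n)) = evenₛ-cong (λ k → a≈b (suc k)) n

  evenₛ-·ₛ : ∀ c a → evenₛ (c ·ₛ a) ≈ₛ c ·ₛ evenₛ a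
  evenₛ-·ₛ c a zero          = refl
  evenₛ-·ₛ c a (suc zero)    = sym (zeroʳ c)
  evenₛ-·ₛ c a (suc (suc n)) = evenₛ-·ₛ c (tailₛ a) n

  evenₛ-+ₛ : ∀ a b → evenₛ (a +ₛ b) ≈ₛ (evenₛ a +ₛ evenₛ b)
  evenₛ-+ₛ a b zero          = refl
  evenₛ-+ₛ a b (suc zero)    = sym (+-identityʳ 0#)
  evenₛ-+ₛ a b (suc (suc n)) = evenₛ-+ₛ (tailₛ a) (tailₛ b) n

  evenₛ-constₛ : ∀ c → evenₛ (constₛ c) ≈ₛ constₛ c
  evenₛ-constₛ c zero          = refl
  evenₛ-constₛ c (suc zero)    = refl
  evenₛ-constₛ c (suc (suc n)) = evenₛ-zero n
    where
    evenₛ-zero : ∀ n → evenₛ (λ _ → 0#) n ≈ 0#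
    evenₛ-zero zero          = refl
    evenₛ-zero (suc zero)    = refl
    evenₛ-zero (suc (suc n)) = evenₛ-zero n

  private
    evenₛ-*ₛ-at : ∀ n a b → (evenₛ a *ₛ evenₛ b) n ≈ evenₛ (a *ₛ b) n
    evenₛ-*ₛ-at zero          a b = refl
    evenₛ-*ₛ-at (suc zero)    a b =
      trans (*ₛ-suc (evenₛ a) (evenₛ b) 0) (trans (+-cong (zeroʳ _) (zeroˡ _)) (+-identityʳ 0#))
    evenₛ-*ₛ-at (suc (suc k)) a b = begin
      (evenₛ a *ₛ evenₛ b) (suc (suc k))
        ≈⟨ *ₛ-suc (evenₛ a) (evenₛ b) (suc k) ⟩
      a 0 * evenₛ (tailₛ b) k + (tailₛ (evenₛ a) *ₛ evenₛ b) (suc k)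
        ≈⟨ +-congˡ (*ₛ-suc (tailₛ (evenₛ a)) (evenₛ b) k) ⟩
      a 0 * evenₛ (tailₛ b) k + (0# * evenₛ b (suc k) + (evenₛ (tailₛ a) *ₛ evenₛ b) k)
        ≈⟨ +-congˡ (trans (+-congʳ (zeroˡ _)) (+-identityˡ _)) ⟩
      a 0 * evenₛ (tailₛ b) k + (evenₛ (tailₛ a) *ₛ evenₛ b) k
        ≈⟨ +-cong (sym (evenₛ-·ₛ (a 0) (tailₛ b) k)) (evenₛ-*ₛ-at k (tailₛ a) b) ⟩
      evenₛ (a 0 ·ₛ tailₛ b) k + evenₛ (tailₛ a *ₛ b) k
        ≈⟨ evenₛ-+ₛ _ _ k ⟨
      evenₛ (a 0 ·ₛ tailₛ b +ₛ (tailₛ a *ₛ b)) k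
        ≈⟨ evenₛ-cong (tailₛ-*ₛ a b) k ⟨
      evenₛ (a *ₛ b) (suc (suc k)) ∎

  evenₛ-*ₛ : ∀ a b → (evenₛ a *ₛ evenₛ b) ≈ₛ evenₛ (a *ₛ b)
  evenₛ-*ₛ a b n = evenₛ-*ₛ-at n a b

module HahnExtonRiccati (R : CommutativeRing 0ℓ 0ℓ) where
  open CommutativeRing R hiding (zero)
  open Q R
  open IntegerCoefficientSolver R
  open RingLemmas R
  open PowerSeries R
  open EvenSeries R

  Riccati : (p σ a : Carrier) → Series → Set
  Riccati p σ a P =
    ((P -ₛ constₛ 1#) -ₛ σ ·ₛ dilₛ p P) ≈ₛ a ·ₛ zₛ ((P -ₛ constₛ 1#) *ₛ dilₛ p P)

  -- Φₛ p w c is evenₛ (Φcoeffs p w c); the coefficients are taken in the variable z².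
  Φcoeffs : (p w : Carrier) → (ℕ → Carrier) → Series
  Φcoeffs p w c n = pow (- 1#) n * pow p (n C 2) * pow (p * (w * w)) n * c n

  module Φ-equations (p w s e : Carrier) (c0 c1 : ℕ → Carrier)
    (He : (1# - s * p) * e ≈ 1#) (H0 : PhiInv p s c0) (H1 : PhiInv p (s * p) c1) where
    open import Relation.Binary.Reasoning.Setoid setoid

    σ pw² : Carrier
    σ = s * p
    pw² = p * (w * w)

    φ₀ φ₁ : Series
    φ₀ = Φcoeffs p w c0
    φ₁ = e ·ₛ Φcoeffs p w c1

    Φ-prefactor : ℕ → Carrier
    Φ-prefactor n = pow (- 1#) n * pow p (n C 2) * pow pw² n

    Φ-prefactor-suc : ∀ n → Φ-prefactor (suc n) ≈ (- pw²) * pow p n * Φ-prefactor n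
    Φ-prefactor-suc n = begin
      (- 1# * pow (- 1#) n) * pow p (suc n C 2) * (pw² * pow pw² n)
        ≈⟨ *-congʳ (*-congˡ (reflexive (≡.cong (pow p) (≡.sym (nCk+nC[k+1]≡[n+1]C[k+1] n 1))))) ⟩
      (- 1# * pow (- 1#) n) * pow p (n C 1 ℕ.+ n C 2) * (pw² * pow pw² n)
        ≈⟨ *-congʳ (*-congˡ (trans (pow-+ p (n C 1) (n C 2)) (*-congʳ (reflexive (≡.cong (pow p) (nC1≡n n)))))) ⟩
      (- 1# * pow (- 1#) n) * (pow p n * pow p (n C 2)) * (pw² * pow pw² n)
        ≈⟨ solve 5 (λ m pn pc a an → (:- :1 :* m) :* (pn :* pc) :* (a :* an) := (:- a) :* pn :* (m :* pc :* an)) refl _ _ _ _ _ ⟩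
      (- pw²) * pow p n * Φ-prefactor n ∎

    c0-from-c1 : ∀ n → e * (1# - σ * pow p n) * c1 n ≈ c0 n
    c0-from-c1 n = inverse-unique (trans (*-comm _ _) inverts) (H0 n)
      where
      inverts : (e * (1# - σ * pow p n) * c1 n) * (poch p p n * poch σ p n) ≈ 1#
      inverts = begin
        (e * (1# - σ * pow p n) * c1 n) * (poch p p n * poch σ p n)
          ≈⟨ solve 5 (λ e x c a b → (e :* x :* c) :* (a :* b) := (e :* c :* a) :* (b :* x)) refl _ _ _ _ _ ⟩
        (e * c1 n * poch p p n) * poch σ p (suc n)
          ≈⟨ *-congˡ (poch-suc σ p n) ⟩
        (e * c1 n * poch p p n) * ((1# - σ) * poch (σ * p) p n)
          ≈⟨ solve 5 (λ e c a x b → (e :* c :* a) :* (x :* b) := (x :* e) :* ((a :* b) :* c)) refl _ _ _ _ _ ⟩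
        ((1# - σ) * e) * ((poch p p n * poch (σ * p) p n) * c1 n)
          ≈⟨ *-cong He (H1 n) ⟩
        1# * 1# ≈⟨ *-identityˡ 1# ⟩
        1# ∎

    c1-from-c0 : ∀ n → (1# - pow p (suc n)) * c0 (suc n) ≈ e * c1 n
    c1-from-c0 n = begin
      (1# - pow p (suc n)) * c0 (suc n)
        ≈⟨ *-identityʳ _ ⟨
      (1# - pow p (suc n)) * c0 (suc n) * 1#
        ≈⟨ *-congˡ He ⟨
      (1# - pow p (suc n)) * c0 (suc n) * ((1# - σ) * e)
        ≈⟨ solve 4 (λ x c y e → x :* c :* (y :* e) := e :* (x :* c :* y)) refl _ _ _ _ ⟩
      e * y ≈⟨ *-congˡ (inverse-unique (trans (*-comm _ _) inverts) (H1 n)) ⟩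
      e * c1 n ∎
      where
      y = (1# - pow p (suc n)) * c0 (suc n) * (1# - σ)
      inverts : y * (poch p p n * poch (σ * p) p n) ≈ 1#
      inverts = begin
        y * (poch p p n * poch (σ * p) p n)
          ≈⟨ solve 5 (λ x c y a b → (x :* c :* y) :* (a :* b) := (a :* x) :* (y :* b) :* c) refl _ _ _ _ _ ⟩
        (poch p p n * (1# - pow p (suc n))) * ((1# - σ) * poch (σ * p) p n) * c0 (suc n)
          ≈⟨ *-congʳ (*-congˡ (poch-suc σ p n)) ⟨
        poch p p (suc n) * poch σ p (suc n) * c0 (suc n)
          ≈⟨ H0 (suc n) ⟩
        1# ∎

    Φ-ν-shift : (φ₁ -ₛ σ ·ₛ dilₛ p φ₁) ≈ₛ φ₀
    Φ-ν-shift n = begin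
      e * (K * c1 n) - σ * (pow p n * (e * (K * c1 n)))
        ≈⟨ solve 5 (λ e k c s x → e :* (k :* c) :- s :* (x :* (e :* (k :* c))) := k :* (e :* (:1 :- s :* x) :* c)) refl e K (c1 n) σ (pow p n) ⟩
      K * (e * (1# - σ * pow p n) * c1 n)
        ≈⟨ *-congˡ (c0-from-c1 n) ⟩
      φ₀ n ∎
      where K = Φ-prefactor n

    Φ-p-difference : (φ₀ -ₛ dilₛ p φ₀) ≈ₛ (- pw²) ·ₛ zₛ (dilₛ p φ₁)
    Φ-p-difference zero = begin
      φ₀ 0 - 1# * φ₀ 0 ≈⟨ solve 1 (λ x → x :- :1 :* x := :0) refl (φ₀ 0) ⟩
      0#               ≈⟨ zeroʳ _ ⟨
      (- pw²) * 0#     ∎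
    Φ-p-difference (suc n) = begin
      K′ * c0 (suc n) - pow p (suc n) * (K′ * c0 (suc n))
        ≈⟨ solve 3 (λ k x c → k :* c :- x :* (k :* c) := k :* ((:1 :- x) :* c)) refl K′ (pow p (suc n)) (c0 (suc n)) ⟩
      K′ * ((1# - pow p (suc n)) * c0 (suc n))
        ≈⟨ *-cong (Φ-prefactor-suc n) (c1-from-c0 n) ⟩
      (- pw²) * pow p n * K * (e * c1 n)
        ≈⟨ solve 5 (λ a x k e c → a :* x :* k :* (e :* c) := a :* (x :* (e :* (k :* c)))) refl (- pw²) (pow p n) K e (c1 n) ⟩
      (- pw²) * (pow p n * (e * (K * c1 n))) ∎
      where K = Φ-prefactor n
            K′ = Φ-prefactor (suc n)

    1-σpⁿ-invertible : ∀ n → Σ Carrier (λ b → (1# - σ * pow p n) * b ≈ 1#)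
    1-σpⁿ-invertible zero    = e , trans (*-congʳ (+-congˡ (-‿cong (*-identityʳ σ)))) He
    1-σpⁿ-invertible (suc k) = poch p p (suc k) * poch (σ * p) p k * c1 (suc k) , (begin
      (1# - σ * (p * pow p k)) * (poch p p (suc k) * poch (σ * p) p k * c1 (suc k))
        ≈⟨ solve 6 (λ s p x a b c → (:1 :- s :* (p :* x)) :* (a :* b :* c) := a :* (b :* (:1 :- s :* p :* x)) :* c) refl σ p (pow p k) _ _ _ ⟩
      poch p p (suc k) * poch (σ * p) p (suc k) * c1 (suc k)
        ≈⟨ H1 (suc k) ⟩
      1# ∎)

    module _ (P : Series) (ric : Riccati p σ pw² P) where
      private
        P₁ E : Series
        P₁ = P -ₛ constₛ 1#
        E  = (P *ₛ φ₀) -ₛ φ₁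

        riccati-dφ₀ : ∀ n → pw² * zₛ (P₁ *ₛ (dilₛ p P *ₛ dilₛ p φ₀)) n
                           ≈ (P *ₛ dilₛ p φ₀) n - dilₛ p φ₀ n - σ * (pow p n * (P *ₛ φ₀) n)
        riccati-dφ₀ n = begin
          pw² * zₛ (P₁ *ₛ (dilₛ p P *ₛ dilₛ p φ₀)) n
            ≈⟨ *-congˡ (zₛ-cong (≈ₛ-sym (*ₛ-assoc P₁ (dilₛ p P) (dilₛ p φ₀))) n) ⟩
          pw² * zₛ ((P₁ *ₛ dilₛ p P) *ₛ dilₛ p φ₀) n
            ≈⟨ *-congˡ (zₛ-*ₛ (P₁ *ₛ dilₛ p P) (dilₛ p φ₀) n) ⟨
          pw² * (zₛ (P₁ *ₛ dilₛ p P) *ₛ dilₛ p φ₀) n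
            ≈⟨ ·ₛ-*ₛ pw² (zₛ (P₁ *ₛ dilₛ p P)) (dilₛ p φ₀) n ⟨
          (pw² ·ₛ zₛ (P₁ *ₛ dilₛ p P) *ₛ dilₛ p φ₀) n
            ≈⟨ *ₛ-congˡ (dilₛ p φ₀) (≈ₛ-sym ric) n ⟩
          ((P₁ -ₛ σ ·ₛ dilₛ p P) *ₛ dilₛ p φ₀) n
            ≈⟨ *ₛ-distribʳ--ₛ P₁ (σ ·ₛ dilₛ p P) (dilₛ p φ₀) n ⟩
          (P₁ *ₛ dilₛ p φ₀) n - (σ ·ₛ dilₛ p P *ₛ dilₛ p φ₀) n
            ≈⟨ +-cong (*ₛ-distribʳ--ₛ P (constₛ 1#) (dilₛ p φ₀) n)
                      (-‿cong (trans (·ₛ-*ₛ σ (dilₛ p P) (dilₛ p φ₀) n) (*-congˡ (sym (dilₛ-*ₛ p P φ₀ n))))) ⟩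
          (P *ₛ dilₛ p φ₀) n - (constₛ 1# *ₛ dilₛ p φ₀) n - σ * (pow p n * (P *ₛ φ₀) n)
            ≈⟨ +-congʳ (+-congˡ (-‿cong (*ₛ-identityˡ (dilₛ p φ₀) n))) ⟩
          (P *ₛ dilₛ p φ₀) n - dilₛ p φ₀ n - σ * (pow p n * (P *ₛ φ₀) n) ∎

        riccati-dφ₁ : ∀ n → pw² * zₛ (P₁ *ₛ dilₛ p φ₁) n
                           ≈ (P *ₛ dilₛ p φ₀) n - dilₛ p φ₀ n - ((P *ₛ φ₀) n - φ₀ n)
        riccati-dφ₁ n = begin
          pw² * zₛ (P₁ *ₛ dilₛ p φ₁) n
            ≈⟨ trans (*ₛ-·ₛ pw² P₁ (zₛ (dilₛ p φ₁)) n) (*-congˡ (*ₛ-zₛ P₁ (dilₛ p φ₁) n)) ⟨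
          (P₁ *ₛ pw² ·ₛ zₛ (dilₛ p φ₁)) n
            ≈⟨ *ₛ-congʳ P₁ difference n ⟩
          (P₁ *ₛ (dilₛ p φ₀ -ₛ φ₀)) n
            ≈⟨ *ₛ-distribˡ--ₛ (dilₛ p φ₀) φ₀ P₁ n ⟩
          (P₁ *ₛ dilₛ p φ₀) n - (P₁ *ₛ φ₀) n
            ≈⟨ +-cong (*ₛ-distribʳ--ₛ P (constₛ 1#) (dilₛ p φ₀) n) (-‿cong (*ₛ-distribʳ--ₛ P (constₛ 1#) φ₀ n)) ⟩
          (P *ₛ dilₛ p φ₀) n - (constₛ 1# *ₛ dilₛ p φ₀) n - ((P *ₛ φ₀) n - (constₛ 1# *ₛ φ₀) n)
            ≈⟨ +-cong (+-congˡ (-‿cong (*ₛ-identityˡ (dilₛ p φ₀) n))) (-‿cong (+-congˡ (-‿cong (*ₛ-identityˡ φ₀ n)))) ⟩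
          (P *ₛ dilₛ p φ₀) n - dilₛ p φ₀ n - ((P *ₛ φ₀) n - φ₀ n) ∎
          where
          difference : pw² ·ₛ zₛ (dilₛ p φ₁) ≈ₛ (dilₛ p φ₀ -ₛ φ₀)
          difference k = begin
            pw² * zₛ (dilₛ p φ₁) k            ≈⟨ solve 2 (λ a z → a :* z := :- ((:- a) :* z)) refl pw² _ ⟩
            - ((- pw²) * zₛ (dilₛ p φ₁) k)    ≈⟨ -‿cong (Φ-p-difference k) ⟨
            - (φ₀ k - pow p k * φ₀ k)         ≈⟨ solve 2 (λ a b → :- (a :- b) := b :- a) refl _ _ ⟩
            dilₛ p φ₀ k - φ₀ k                ∎

        E-equation : ∀ n → (1# - σ * pow p n) * E n ≈ pw² * zₛ (P₁ *ₛ dilₛ p E) n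
        E-equation n = begin
          (1# - σ * pow p n) * ((P *ₛ φ₀) n - φ₁ n)
            ≈⟨ solve 6 (λ a h s x y d → (:1 :- s :* x) :* (a :- h) := (y :- d :- s :* (x :* a)) :- (y :- d :- (a :- (h :- s :* (x :* h))))) refl
                 ((P *ₛ φ₀) n) (φ₁ n) σ (pow p n) ((P *ₛ dilₛ p φ₀) n) (dilₛ p φ₀ n) ⟩
          ((P *ₛ dilₛ p φ₀) n - dilₛ p φ₀ n - σ * (pow p n * (P *ₛ φ₀) n))
            - ((P *ₛ dilₛ p φ₀) n - dilₛ p φ₀ n - ((P *ₛ φ₀) n - (φ₁ n - σ * (pow p n * φ₁ n))))
            ≈⟨ +-cong (sym (riccati-dφ₀ n))
                      (-‿cong (trans (+-congˡ (-‿cong (+-congˡ (-‿cong (Φ-ν-shift n))))) (sym (riccati-dφ₁ n)))) ⟩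
          pw² * zₛ (P₁ *ₛ (dilₛ p P *ₛ dilₛ p φ₀)) n - pw² * zₛ (P₁ *ₛ dilₛ p φ₁) n
            ≈⟨ solve 3 (λ a x y → a :* x :- a :* y := a :* (x :- y)) refl pw² _ _ ⟩
          pw² * (zₛ (P₁ *ₛ (dilₛ p P *ₛ dilₛ p φ₀)) n - zₛ (P₁ *ₛ dilₛ p φ₁) n)
            ≈⟨ *-congˡ (zₛ--ₛ _ _ n) ⟨
          pw² * zₛ ((P₁ *ₛ (dilₛ p P *ₛ dilₛ p φ₀)) -ₛ (P₁ *ₛ dilₛ p φ₁)) n
            ≈⟨ *-congˡ (zₛ-cong (≈ₛ-trans (≈ₛ-sym (*ₛ-distribˡ--ₛ (dilₛ p P *ₛ dilₛ p φ₀) (dilₛ p φ₁) P₁)) (*ₛ-congʳ P₁ dil-E)) n) ⟩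
          pw² * zₛ (P₁ *ₛ dilₛ p E) n ∎
          where
          dil-E : ((dilₛ p P *ₛ dilₛ p φ₀) -ₛ dilₛ p φ₁) ≈ₛ dilₛ p E
          dil-E k = trans (+-congʳ (sym (dilₛ-*ₛ p P φ₀ k)))
                          (solve 3 (λ x a b → x :* a :- x :* b := x :* (a :- b)) refl (pow p k) _ _)

        E-vanishes : ∀ n → E n ≈ 0#
        E-vanishes = <-rec (λ n → E n ≈ 0#) λ n E<n≈0 →
          unit-cancel-zero (proj₂ (1-σpⁿ-invertible n)) (trans (E-equation n) (earlier-terms n E<n≈0))
          where
          earlier-terms : ∀ n → (∀ {j} → j < n → E j ≈ 0#) → pw² * zₛ (P₁ *ₛ dilₛ p E) n ≈ 0#
          earlier-terms zero    _      = zeroʳ pw²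
          earlier-terms (suc k) E<n≈0 = trans (*-congˡ (sumTo-zero k _ λ i _ →
              trans (*-congˡ (trans (*-congˡ (E<n≈0 (s≤s (ℕP.m∸n≤m k i)))) (zeroʳ _))) (zeroʳ _)))
            (zeroʳ pw²)

      riccati⇒Φ-ratio : (P *ₛ φ₀) ≈ₛ φ₁
      riccati⇒Φ-ratio n = begin
        (P *ₛ φ₀) n        ≈⟨ solve 2 (λ a b → a := (a :- b) :+ b) refl ((P *ₛ φ₀) n) (φ₁ n) ⟩
        E n + φ₁ n         ≈⟨ +-congʳ (E-vanishes n) ⟩
        0# + φ₁ n          ≈⟨ +-identityˡ _ ⟩
        φ₁ n               ∎

  riccati⇒BesselRatioIs : ∀ {p w s e c0 c1} → (1# - s * p) * e ≈ 1# → PhiInv p s c0 → PhiInv p (s * p) c1 →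
    ∀ {P S} → Riccati p (s * p) (p * (w * w)) P → S ≈ₛ zₛ (evenₛ (w ·ₛ P)) →
    BesselRatioIs p w e c0 c1 S
  riccati⇒BesselRatioIs {p} {w} {s} {e} {c0} {c1} He H0 H1 {P} {S} ric S≈ = ≈ₛ-sym (begin
    S *ₛ Φₛ p w c0                                 ≈⟨ *ₛ-congˡ (Φₛ p w c0) S≈ ⟩
    zₛ (evenₛ (w ·ₛ P)) *ₛ evenₛ φ₀                ≈⟨ zₛ-*ₛ (evenₛ (w ·ₛ P)) (evenₛ φ₀) ⟩
    zₛ (evenₛ (w ·ₛ P) *ₛ evenₛ φ₀)                ≈⟨ zₛ-cong (evenₛ-*ₛ (w ·ₛ P) φ₀) ⟩
    zₛ (evenₛ (w ·ₛ P *ₛ φ₀))                      ≈⟨ zₛ-cong (evenₛ-cong (·ₛ-*ₛ w P φ₀)) ⟩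
    zₛ (evenₛ (w ·ₛ (P *ₛ φ₀)))                    ≈⟨ zₛ-cong (evenₛ-cong (λ n → *-congˡ (riccati⇒Φ-ratio P ric n))) ⟩
    zₛ (evenₛ (w ·ₛ e ·ₛ Φcoeffs p w c1))          ≈⟨ zₛ-cong (evenₛ-cong (λ n → trans (sym (*-assoc w e _)) (*-congʳ (*-comm w e)))) ⟩
    zₛ (evenₛ ((e * w) ·ₛ Φcoeffs p w c1))         ≈⟨ zₛ-cong (evenₛ-·ₛ (e * w) (Φcoeffs p w c1)) ⟩
    zₛ ((e * w) ·ₛ Φₛ p w c1)                      ≈⟨ zₛ-cong (constₛ-*ₛ (e * w) (Φₛ p w c1)) ⟨
    zₛ (constₛ (e * w) *ₛ Φₛ p w c1)               ∎)
    where
    open Φ-equations p w s e c0 c1 He H0 H1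
    open import Relation.Binary.Reasoning.Setoid seriesSetoid

module RiccatiSolutions (R : CommutativeRing 0ℓ 0ℓ) where
  open CommutativeRing R hiding (zero)
  open Q R
  open IntegerCoefficientSolver R
  open RingLemmas R
  open PowerSeries R
  open HahnExtonRiccati R
  open import Relation.Binary.Reasoning.Setoid setoid

  module FromRecurrence (q t qi ti ui : Carrier) (q·qi≈1 : q * qi ≈ 1#) (t·ti≈1 : t * ti ≈ 1#) (hu : (1# - q) * ui ≈ 1#)
    (β : Series)
    (β-initial : qnum+ν q t ui 1 * β 0 ≈ 1#)
    (β-recurrence : ∀ k → qnum+ν q t ui (suc (suc k)) * β (suc k)
                           ≈ (1# - q) * β k + t * q * (β *ₛ dilₛ q β) k) where

    w : Carrier
    w = 1# - q

    private
      ββ : Series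
      ββ = β *ₛ dilₛ q β

      -- (1-q) ui = 1 inserted twice, so that the remaining step is a ring identity
      recurrence-scaled : ∀ k x → x * (w * β k + t * q * ββ k)
                                  ≈ x * ((w * ui) * (w * β k) + (w * ui) * (w * ui) * (t * q * ββ k))
      recurrence-scaled k x = *-congˡ (+-cong
        (trans (sym (*-identityˡ _)) (*-congʳ (sym hu)))
        (trans (sym (trans (*-congʳ (*-identityˡ 1#)) (*-identityˡ _))) (*-congʳ (sym (*-cong hu hu)))))

    a₊ : Carrier
    a₊ = q * t * ui

    P₊ : Series
    P₊ = constₛ 1# +ₛ a₊ ·ₛ dilₛ q β

    P₊-product : ((P₊ -ₛ constₛ 1#) *ₛ dilₛ q P₊) ≈ₛ (a₊ ·ₛ dilₛ q β +ₛ (a₊ * a₊) ·ₛ dilₛ q ββ)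
    P₊-product = ≈ₛ-trans (*ₛ-cong P₊-1 dilₛ-P₊)
      (≈ₛ-trans (*ₛ-distribˡ-+ₛ (constₛ 1#) (a₊ ·ₛ dilₛ q (dilₛ q β)) (a₊ ·ₛ dilₛ q β))
      (λ n → +-cong (trans (*ₛ-comm (a₊ ·ₛ dilₛ q β) (constₛ 1#) n) (*ₛ-identityˡ (a₊ ·ₛ dilₛ q β) n))
        (trans (·ₛ-*ₛ a₊ (dilₛ q β) (a₊ ·ₛ dilₛ q (dilₛ q β)) n)
        (trans (*-congˡ (*ₛ-·ₛ a₊ (dilₛ q β) (dilₛ q (dilₛ q β)) n))
        (trans (sym (*-assoc _ _ _)) (*-congˡ (sym (dilₛ-*ₛ q β (dilₛ q β) n))))))))
      where
      P₊-1 : (P₊ -ₛ constₛ 1#) ≈ₛ a₊ ·ₛ dilₛ q β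
      P₊-1 zero    = solve 1 (λ x → (:1 :+ x) :- :1 := x) refl _
      P₊-1 (suc n) = solve 1 (λ x → (:0 :+ x) :- :0 := x) refl _
      dilₛ-P₊ : dilₛ q P₊ ≈ₛ (constₛ 1# +ₛ a₊ ·ₛ dilₛ q (dilₛ q β))
      dilₛ-P₊ zero    = solve 2 (λ c b → :1 :* (:1 :+ c :* (:1 :* b)) := :1 :+ c :* (:1 :* (:1 :* b))) refl a₊ (β 0)
      dilₛ-P₊ (suc n) = solve 3 (λ x c b → x :* (:0 :+ c :* (x :* b)) := :0 :+ c :* (x :* (x :* b))) refl (pow q (suc n)) a₊ (β (suc n))

    P₊-riccati : Riccati q (t * q) (q * (w * w)) P₊
    P₊-riccati zero = begin
      (1# + a₊ * (1# * β 0)) - 1# - (t * q) * (1# * (1# + a₊ * (1# * β 0)))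
        ≈⟨ solve 4 (λ q t u b → (:1 :+ (q :* t :* u) :* (:1 :* b)) :- :1 :- (t :* q) :* (:1 :* (:1 :+ (q :* t :* u) :* (:1 :* b))) := q :* t :* ((:1 :- (q :* :1) :* t) :* u :* b) :- q :* t) refl q t ui (β 0) ⟩
      q * t * (qnum+ν q t ui 1 * β 0) - q * t
        ≈⟨ +-congʳ (*-congˡ β-initial) ⟩
      q * t * 1# - q * t
        ≈⟨ solve 2 (λ q t → q :* t :* :1 :- q :* t := :0) refl q t ⟩
      0#
        ≈⟨ zeroʳ _ ⟨
      (q * (w * w)) * 0# ∎
    P₊-riccati (suc k) = begin
      (0# + a₊ * (q * x * β (suc k))) - 0# - (t * q) * (q * x * (0# + a₊ * (q * x * β (suc k))))
        ≈⟨ solve 5 (λ q t u x b → (:0 :+ (q :* t :* u) :* (q :* x :* b)) :- :0 :- (t :* q) :* (q :* x :* (:0 :+ (q :* t :* u) :* (q :* x :* b))) := (q :* (q :* x)) :* t :* ((:1 :- (q :* (q :* x)) :* t) :* u :* b)) refl q t ui x (β (suc k)) ⟩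
      (q * (q * x)) * t * (qnum+ν q t ui (suc (suc k)) * β (suc k))
        ≈⟨ *-congˡ (β-recurrence k) ⟩
      (q * (q * x)) * t * (w * β k + t * q * ββ k)
        ≈⟨ recurrence-scaled k _ ⟩
      (q * (q * x)) * t * ((w * ui) * (w * β k) + (w * ui) * (w * ui) * (t * q * ββ k))
        ≈⟨ solve 6 (λ q t u x b y → (q :* (q :* x)) :* t :* (((:1 :- q) :* u) :* ((:1 :- q) :* b) :+ ((:1 :- q) :* u) :* ((:1 :- q) :* u) :* (t :* q :* y)) := (q :* ((:1 :- q) :* (:1 :- q))) :* ((q :* t :* u) :* (x :* b) :+ ((q :* t :* u) :* (q :* t :* u)) :* (x :* y))) refl q t ui x (β k) (ββ k) ⟩
      (q * (w * w)) * (a₊ * (x * β k) + (a₊ * a₊) * (x * ββ k))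
        ≈⟨ *-congˡ (P₊-product k) ⟨
      (q * (w * w)) * zₛ ((P₊ -ₛ constₛ 1#) *ₛ dilₛ q P₊) (suc k) ∎
      where x = pow q k

    a₋ : Carrier
    a₋ = - (t * q * ui)

    P₋ : Series
    P₋ = a₋ ·ₛ dilₛ (t * q) β

    private
      qⁿ·qiⁿ≈1 : ∀ n → pow qi n * pow q n ≈ 1#
      qⁿ·qiⁿ≈1 = pow-inverse (trans (*-comm qi q) q·qi≈1)

    dilₛ-P₋ : dilₛ qi P₋ ≈ₛ a₋ ·ₛ dilₛ t β
    dilₛ-P₋ n = begin
      pow qi n * (a₋ * (pow (t * q) n * β n))           ≈⟨ *-congˡ (*-congˡ (*-congʳ (pow-* t q n))) ⟩
      pow qi n * (a₋ * ((pow t n * pow q n) * β n))     ≈⟨ solve 5 (λ r d y x b → r :* (d :* ((y :* x) :* b)) := (d :* (y :* b)) :* (r :* x)) refl (pow qi n) a₋ (pow t n) (pow q n) (β n) ⟩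
      (a₋ * (pow t n * β n)) * (pow qi n * pow q n)     ≈⟨ *-congˡ (qⁿ·qiⁿ≈1 n) ⟩
      (a₋ * (pow t n * β n)) * 1#                       ≈⟨ *-identityʳ _ ⟩
      a₋ * (pow t n * β n)                              ∎

    P₋-product : (P₋ *ₛ dilₛ qi P₋) ≈ₛ (a₋ * a₋) ·ₛ dilₛ t ββ
    P₋-product = ≈ₛ-trans (*ₛ-congʳ P₋ dilₛ-P₋) λ n →
      trans (·ₛ-*ₛ a₋ (dilₛ (t * q) β) (a₋ ·ₛ dilₛ t β) n)
      (trans (*-congˡ (*ₛ-·ₛ a₋ (dilₛ (t * q) β) (dilₛ t β) n))
      (trans (sym (*-assoc _ _ _)) (*-congˡ (dilₛ-tq n))))
      where
      dilₛ-tq : (dilₛ (t * q) β *ₛ dilₛ t β) ≈ₛ dilₛ t ββ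
      dilₛ-tq = ≈ₛ-trans (*ₛ-congˡ (dilₛ t β) (λ n → trans (*-congʳ (pow-* t q n)) (*-assoc _ _ _)))
        (≈ₛ-trans (≈ₛ-sym (dilₛ-*ₛ t (dilₛ q β) β)) (dilₛ-cong t (*ₛ-comm (dilₛ q β) β)))

    P₋-riccati : Riccati qi (ti * qi) (qi * (w * w)) P₋
    P₋-riccati zero = begin
      a₋ * (1# * β 0) - 1# - (ti * qi) * (1# * (a₋ * (1# * β 0)))
        ≈⟨ solve 6 (λ q t u b ti qi → (:- (t :* q :* u)) :* (:1 :* b) :- :1 :- (ti :* qi) :* (:1 :* ((:- (t :* q :* u)) :* (:1 :* b))) := (:- ((q :* :1) :* t)) :* (u :* b) :+ (t :* ti) :* (q :* qi) :* (u :* b) :- :1) refl q t ui (β 0) ti qi ⟩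
      (- ((q * 1#) * t)) * (ui * β 0) + (t * ti) * (q * qi) * (ui * β 0) - 1#
        ≈⟨ +-congʳ (+-congˡ (*-congʳ (*-cong t·ti≈1 q·qi≈1))) ⟩
      (- ((q * 1#) * t)) * (ui * β 0) + 1# * 1# * (ui * β 0) - 1#
        ≈⟨ solve 4 (λ q t u b → (:- ((q :* :1) :* t)) :* (u :* b) :+ :1 :* :1 :* (u :* b) :- :1 := (:1 :- (q :* :1) :* t) :* u :* b :- :1) refl q t ui (β 0) ⟩
      qnum+ν q t ui 1 * β 0 - 1#
        ≈⟨ +-congʳ β-initial ⟩
      1# - 1#
        ≈⟨ -‿inverseʳ 1# ⟩
      0#
        ≈⟨ zeroʳ _ ⟨
      (qi * (w * w)) * 0# ∎
    P₋-riccati (suc k) = begin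
      a₋ * (pow (t * q) (suc k) * β (suc k)) - 0# - (ti * qi) * (qi * r * (a₋ * (pow (t * q) (suc k) * β (suc k))))
        ≈⟨ +-cong (+-congʳ (*-congˡ (*-congʳ (pow-* t q (suc k))))) (-‿cong (*-congˡ (*-congˡ (*-congˡ (*-congʳ (pow-* t q (suc k))))))) ⟩
      a₋ * ((t * y) * (q * x) * β (suc k)) - 0# - (ti * qi) * (qi * r * (a₋ * ((t * y) * (q * x) * β (suc k))))
        ≈⟨ solve 9 (λ q t u x y r b ti qi → (:- (t :* q :* u)) :* ((t :* y) :* (q :* x) :* b) :- :0 :- (ti :* qi) :* (qi :* r :* ((:- (t :* q :* u)) :* ((t :* y) :* (q :* x) :* b))) := (:- ((t :* y) :* (q :* (q :* x)) :* t :* u :* b)) :+ ((t :* ti) :* (q :* qi) :* ((qi :* r) :* (q :* x))) :* ((t :* y) :* u :* b)) refl q t ui x y r (β (suc k)) ti qi ⟩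
      (- ((t * y) * (q * (q * x)) * t * ui * β (suc k))) + ((t * ti) * (q * qi) * ((qi * r) * (q * x))) * ((t * y) * ui * β (suc k))
        ≈⟨ +-congˡ (*-congʳ (*-cong (*-cong t·ti≈1 q·qi≈1) (qⁿ·qiⁿ≈1 (suc k)))) ⟩
      (- ((t * y) * (q * (q * x)) * t * ui * β (suc k))) + (1# * 1# * 1#) * ((t * y) * ui * β (suc k))
        ≈⟨ solve 6 (λ q t u x y b → (:- ((t :* y) :* (q :* (q :* x)) :* t :* u :* b)) :+ (:1 :* :1 :* :1) :* ((t :* y) :* u :* b) := (t :* y) :* (((:1 :- (q :* (q :* x)) :* t) :* u) :* b)) refl q t ui x y (β (suc k)) ⟩
      (t * y) * (qnum+ν q t ui (suc (suc k)) * β (suc k))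
        ≈⟨ *-congˡ (β-recurrence k) ⟩
      (t * y) * (w * β k + t * q * ββ k)
        ≈⟨ recurrence-scaled k _ ⟩
      (t * y) * ((w * ui) * (w * β k) + (w * ui) * (w * ui) * (t * q * ββ k))
        ≈⟨ *-identityˡ _ ⟨
      1# * ((t * y) * ((w * ui) * (w * β k) + (w * ui) * (w * ui) * (t * q * ββ k)))
        ≈⟨ *-congʳ (trans (*-comm qi q) q·qi≈1) ⟨
      (qi * q) * ((t * y) * ((w * ui) * (w * β k) + (w * ui) * (w * ui) * (t * q * ββ k)))
        ≈⟨ solve 7 (λ q t u y b xx qi → (qi :* q) :* ((t :* y) :* (((:1 :- q) :* u) :* ((:1 :- q) :* b) :+ ((:1 :- q) :* u) :* ((:1 :- q) :* u) :* (t :* q :* xx))) := (qi :* ((:1 :- q) :* (:1 :- q))) :* (((:- (t :* q :* u)) :* (:- (t :* q :* u))) :* (y :* xx) :- (:- (t :* q :* u)) :* (y :* b))) refl q t ui y (β k) (ββ k) qi ⟩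
      (qi * (w * w)) * ((a₋ * a₋) * (y * ββ k) - a₋ * (y * β k))
        ≈⟨ *-congˡ (trans (*ₛ-distribʳ--ₛ P₋ (constₛ 1#) (dilₛ qi P₋) k)
                          (+-cong (P₋-product k) (-‿cong (trans (*ₛ-identityˡ (dilₛ qi P₋) k) (dilₛ-P₋ k))))) ⟨
      (qi * (w * w)) * zₛ ((P₋ -ₛ constₛ 1#) *ₛ dilₛ qi P₋) (suc k) ∎
      where x = pow q k
            y = pow t k
            r = pow qi k

module Poly3Arithmetic where

  Monomial : Set
  Monomial = ℕ × ℕ × ℕ × ℕ

  infixr 7 _·ᴹ_ _⊗_

  _·ᴹ_ : Monomial → Poly3 → Poly3
  (c , i , j , k) ·ᴹ f = map (λ { (c′ , i′ , j′ , k′) → (c ℕ.* c′ , i ℕ.+ i′ , j ℕ.+ j′ , k ℕ.+ k′) }) f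

  _⊗_ : Poly3 → Poly3 → Poly3
  []      ⊗ g = []
  (m ∷ f) ⊗ g = m ·ᴹ g ++ f ⊗ g

  1ᴾ qᴾ tᴾ : Poly3
  1ᴾ = (1 , 0 , 0 , 0) ∷ []
  qᴾ = (1 , 1 , 0 , 0) ∷ []
  tᴾ = (1 , 0 , 1 , 0) ∷ []

  _^ᴾ_ : Poly3 → ℕ → Poly3
  f ^ᴾ zero  = 1ᴾ
  f ^ᴾ suc n = f ⊗ f ^ᴾ n

  prodᴾ : ℕ → (ℕ → Poly3) → Poly3
  prodᴾ zero    f = 1ᴾ
  prodᴾ (suc n) f = prodᴾ n f ⊗ f n

  sumᴾ : ℕ → (ℕ → Poly3) → Poly3
  sumᴾ zero    f = []
  sumᴾ (suc n) f = sumᴾ n f ++ f n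

  [_]ᴾ : ℕ → Poly3
  [ zero  ]ᴾ = []
  [ suc k ]ᴾ = (1 , k , 0 , 0) ∷ [ k ]ᴾ

  -- [k+ν]_q = [k]_q + q^k [ν]_q
  [_+ν]ᴾ : ℕ → Poly3
  [ k +ν]ᴾ = [ k ]ᴾ ++ (1 , k , 0 , 1) ∷ []

module NumeratorPolynomials where
  open Poly3Arithmetic

  -- D_{1+m} / (D_a D_c [1+m+ν]_q) when a + c = 1 + m with a, c ≥ 1:
  -- every exponent is ⌊(1+m)/j⌋ - ⌊a/j⌋ - ⌊c/j⌋ ≥ 0, and the factor j = 1+m is the one divided out.
  cofactor : ℕ → ℕ → ℕ → Poly3
  cofactor m a c = prodᴾ m (λ j → [ suc j +ν]ᴾ ^ᴾ (suc m / suc j ∸ (a / suc j ℕ.+ c / suc j)))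

  -- D_{2+k} times the recurrence for β_i = N_{1+i} / D_{1+i}:
  -- [2+k+ν] β_{1+k} = β_0 β_k + q^{ν+1} Σ_{i<k} q^{k-i} β_i β_{k-i}.
  Nstep : ℕ → (ℕ → Poly3) → Poly3
  Nstep zero    M = 1ᴾ
  Nstep (suc k) M = cofactor (suc k) 1 (suc k) ⊗ M 1 ⊗ M (suc k)
                 ++ sumᴾ k (λ i → tᴾ ⊗ qᴾ ^ᴾ suc (k ∸ i) ⊗ cofactor (suc k) (suc i) (suc (k ∸ i))
                                     ⊗ M (suc i) ⊗ M (suc (k ∸ i)))

  Nupto : ℕ → ℕ → Poly3
  Nupto zero    i = []
  Nupto (suc k) i with i ≤? k
  ... | yes _ = Nupto k i
  ... | no  _ = Nstep k (Nupto k)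

  N : ℕ → Poly3
  N n = Nupto n n

  N-suc : ∀ k → N (suc k) ≡ Nstep k (Nupto k)
  N-suc k with suc k ≤? k
  ... | yes 1+k≤k = contradiction 1+k≤k (ℕP.1+n≰n)
  ... | no  _     = ≡.refl

  Nupto-stable : ∀ {i k} → i ≤ k → Nupto k i ≡ N i
  Nupto-stable {k = zero}  ℕ.z≤n = ≡.refl
  Nupto-stable {i} {suc k} i≤1+k with i ≤? k
  ... | yes i≤k = Nupto-stable i≤k
  ... | no  i≰k with ℕP.m≤n⇒m<n∨m≡n i≤1+k
  ...   | inj₁ i<1+k  = contradiction (ℕP.≤-pred i<1+k) i≰k
  ...   | inj₂ ≡.refl = ≡.sym (N-suc k)

/-superadditive : ∀ a c n .{{_ : ℕ.NonZero n}} → a / n ℕ.+ c / n ≤ (a ℕ.+ c) / n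
/-superadditive a c n = ≡.subst (_≤ (a ℕ.+ c) / n) (m*n/n≡m (a / n ℕ.+ c / n) n)
  (/-monoˡ-≤ n (≡.subst (_≤ a ℕ.+ c) (≡.sym (ℕP.*-distribʳ-+ n (a / n) (c / n)))
    (ℕP.+-mono-≤ (m/n*n≤m a n) (m/n*n≤m c n))))

summand≤ : ∀ {a c m} → 1 ≤ c → a ℕ.+ c ≡ suc m → a ≤ m
summand≤ {a} {c} 1≤c a+c≡1+m = ℕP.≤-pred (≡.subst (suc a ≤_) a+c≡1+m
  (≡.subst (_≤ a ℕ.+ c) (ℕP.+-comm a 1) (ℕP.+-monoʳ-≤ a 1≤c)))

module Poly3Evaluation (R : CommutativeRing 0ℓ 0ℓ) (x y b : CommutativeRing.Carrier R) where
  open CommutativeRing R hiding (zero)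
  open Q R
  open IntegerCoefficientSolver R
  open RingLemmas R
  open Poly3Arithmetic
  open import Relation.Binary.Reasoning.Setoid setoid

  ⟦_⟧ : Poly3 → Carrier
  ⟦ f ⟧ = eval3 f x y b

  ⟦_⟧ᴹ : Monomial → Carrier
  ⟦ c , i , j , k ⟧ᴹ = nat c * pow x i * pow y j * pow b k

  ⟦++⟧ : ∀ f g → ⟦ f ++ g ⟧ ≈ ⟦ f ⟧ + ⟦ g ⟧
  ⟦++⟧ []      g = sym (+-identityˡ _)
  ⟦++⟧ (m ∷ f) g = trans (+-congˡ (⟦++⟧ f g)) (sym (+-assoc _ _ _))

  ⟦·ᴹ⟧ : ∀ m g → ⟦ m ·ᴹ g ⟧ ≈ ⟦ m ⟧ᴹ * ⟦ g ⟧
  ⟦·ᴹ⟧ m                 []                     = sym (zeroʳ _)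
  ⟦·ᴹ⟧ m@(c , i , j , k) ((c′ , i′ , j′ , k′) ∷ g) = begin
    nat (c ℕ.* c′) * pow x (i ℕ.+ i′) * pow y (j ℕ.+ j′) * pow b (k ℕ.+ k′) + ⟦ m ·ᴹ g ⟧
      ≈⟨ +-cong (*-cong (*-cong (*-cong (nat-* c c′) (pow-+ x i i′)) (pow-+ y j j′)) (pow-+ b k k′)) (⟦·ᴹ⟧ m g) ⟩
    (nat c * nat c′) * (pow x i * pow x i′) * (pow y j * pow y j′) * (pow b k * pow b k′) + ⟦ m ⟧ᴹ * ⟦ g ⟧
      ≈⟨ solve 9 (λ n n′ a a′ d d′ e e′ z → (n :* n′) :* (a :* a′) :* (d :* d′) :* (e :* e′) :+ (n :* a :* d :* e) :* z := (n :* a :* d :* e) :* (n′ :* a′ :* d′ :* e′ :+ z)) refl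
           (nat c) (nat c′) (pow x i) (pow x i′) (pow y j) (pow y j′) (pow b k) (pow b k′) ⟦ g ⟧ ⟩
    ⟦ m ⟧ᴹ * ⟦ (c′ , i′ , j′ , k′) ∷ g ⟧ ∎

  ⟦⊗⟧ : ∀ f g → ⟦ f ⊗ g ⟧ ≈ ⟦ f ⟧ * ⟦ g ⟧
  ⟦⊗⟧ []      g = sym (zeroˡ _)
  ⟦⊗⟧ (m ∷ f) g = trans (⟦++⟧ (m ·ᴹ g) (f ⊗ g))
    (trans (+-cong (⟦·ᴹ⟧ m g) (⟦⊗⟧ f g)) (sym (distribʳ _ _ _)))

  ⟦1ᴾ⟧ : ⟦ 1ᴾ ⟧ ≈ 1#
  ⟦1ᴾ⟧ = solve 0 ((:1 :+ :0) :* :1 :* :1 :* :1 :+ :0 := :1) refl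

  ⟦qᴾ⟧ : ⟦ qᴾ ⟧ ≈ x
  ⟦qᴾ⟧ = solve 1 (λ x → (:1 :+ :0) :* (x :* :1) :* :1 :* :1 :+ :0 := x) refl x

  ⟦tᴾ⟧ : ⟦ tᴾ ⟧ ≈ y
  ⟦tᴾ⟧ = solve 1 (λ y → (:1 :+ :0) :* :1 :* (y :* :1) :* :1 :+ :0 := y) refl y

  ⟦^ᴾ⟧ : ∀ f n → ⟦ f ^ᴾ n ⟧ ≈ pow ⟦ f ⟧ n
  ⟦^ᴾ⟧ f zero    = ⟦1ᴾ⟧
  ⟦^ᴾ⟧ f (suc n) = trans (⟦⊗⟧ f (f ^ᴾ n)) (*-congˡ (⟦^ᴾ⟧ f n))

  ⟦prodᴾ⟧ : ∀ n f → ⟦ prodᴾ n f ⟧ ≈ prodBelow n (λ j → ⟦ f j ⟧)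
  ⟦prodᴾ⟧ zero    f = ⟦1ᴾ⟧
  ⟦prodᴾ⟧ (suc n) f = trans (⟦⊗⟧ (prodᴾ n f) (f n)) (*-congʳ (⟦prodᴾ⟧ n f))

  ⟦sumᴾ⟧ : ∀ n f → ⟦ sumᴾ n f ⟧ ≈ sumBelow n (λ j → ⟦ f j ⟧)
  ⟦sumᴾ⟧ zero    f = refl
  ⟦sumᴾ⟧ (suc n) f = trans (⟦++⟧ (sumᴾ n f) (f n)) (+-congʳ (⟦sumᴾ⟧ n f))

  ⟦[]ᴾ⟧ : ∀ k → ⟦ [ k ]ᴾ ⟧ * (1# - x) ≈ 1# - pow x k
  ⟦[]ᴾ⟧ zero    = solve 1 (λ x → :0 :* (:1 :- x) := :1 :- :1) refl x
  ⟦[]ᴾ⟧ (suc k) = begin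
    ((1# + 0#) * pow x k * 1# * 1# + ⟦ [ k ]ᴾ ⟧) * (1# - x)
      ≈⟨ solve 3 (λ x p g → ((:1 :+ :0) :* p :* :1 :* :1 :+ g) :* (:1 :- x) := p :- x :* p :+ g :* (:1 :- x)) refl x (pow x k) ⟦ [ k ]ᴾ ⟧ ⟩
    pow x k - x * pow x k + ⟦ [ k ]ᴾ ⟧ * (1# - x)
      ≈⟨ +-congˡ (⟦[]ᴾ⟧ k) ⟩
    pow x k - x * pow x k + (1# - pow x k)
      ≈⟨ solve 2 (λ p q → p :- q :+ (:1 :- p) := :1 :- q) refl (pow x k) (x * pow x k) ⟩
    1# - pow x (suc k) ∎

  ⟦[+ν]ᴾ⟧ : ∀ {t ui} → (1# - x) * ui ≈ 1# → b ≈ (1# - t) * ui → ∀ k → ⟦ [ k +ν]ᴾ ⟧ ≈ qnum+ν x t ui k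
  ⟦[+ν]ᴾ⟧ {t} {ui} hu hb k = begin
    ⟦ [ k ]ᴾ ++ (1 , k , 0 , 1) ∷ [] ⟧
      ≈⟨ ⟦++⟧ [ k ]ᴾ _ ⟩
    ⟦ [ k ]ᴾ ⟧ + ((1# + 0#) * pow x k * 1# * (b * 1#) + 0#)
      ≈⟨ +-cong (sym (trans (*-congˡ hu) (*-identityʳ _))) (+-congʳ (*-congˡ (*-congʳ hb))) ⟩
    ⟦ [ k ]ᴾ ⟧ * ((1# - x) * ui) + ((1# + 0#) * pow x k * 1# * ((1# - t) * ui * 1#) + 0#)
      ≈⟨ +-congʳ (trans (sym (*-assoc _ _ _)) (*-congʳ (⟦[]ᴾ⟧ k))) ⟩
    (1# - pow x k) * ui + ((1# + 0#) * pow x k * 1# * ((1# - t) * ui * 1#) + 0#)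
      ≈⟨ solve 3 (λ p t u → (:1 :- p) :* u :+ ((:1 :+ :0) :* p :* :1 :* ((:1 :- t) :* u :* :1) :+ :0) := (:1 :- p :* t) :* u) refl (pow x k) t ui ⟩
    qnum+ν x t ui k ∎

module CoefficientRecurrence (R : CommutativeRing 0ℓ 0ℓ) where
  open CommutativeRing R hiding (zero)
  open Q R
  open RingLemmas R
  open PowerSeries R using (dilₛ)
  open Poly3Arithmetic
  open NumeratorPolynomials
  open IntegerCoefficientSolver R
  open import Relation.Binary.Reasoning.Setoid setoid

  module _ (q t ui : Carrier) (hu : (1# - q) * ui ≈ 1#) where
    open Poly3Evaluation R q t ((1# - t) * ui)

    X : ℕ → Carrier
    X = qnum+ν q t ui

    D-extend : ∀ {a} m → a ≤ m → D q t ui a ≈ prodBelow m (λ j → pow (X (suc j)) (a / suc j))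
    D-extend m a≤m = sym (prodBelow-ones m _ a≤m λ j a≤j j<m →
      reflexive (≡.cong (pow (X (suc j))) (m<n⇒m/n≡0 (s≤s a≤j))))

    ⟦cofactor⟧ : ∀ m a c → ⟦ cofactor m a c ⟧
                 ≈ prodBelow m (λ j → pow (X (suc j)) (suc m / suc j ∸ (a / suc j ℕ.+ c / suc j)))
    ⟦cofactor⟧ m a c = trans (⟦prodᴾ⟧ m _) (prodBelow-cong m λ j _ →
      trans (⟦^ᴾ⟧ [ suc j +ν]ᴾ (e j)) (pow-cong (e j) (⟦[+ν]ᴾ⟧ hu refl (suc j))))
      where e = λ j → suc m / suc j ∸ (a / suc j ℕ.+ c / suc j)

    D-factorisation : ∀ m {a c} → 1 ≤ a → 1 ≤ c → a ℕ.+ c ≡ suc m →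
      D q t ui a * D q t ui c * ⟦ cofactor m a c ⟧ * X (suc m) ≈ D q t ui (suc m)
    D-factorisation m {a} {c} 1≤a 1≤c a+c≡1+m = begin
      D q t ui a * D q t ui c * ⟦ cofactor m a c ⟧ * X (suc m)
        ≈⟨ *-congʳ (*-cong (*-cong (D-extend m (summand≤ 1≤c a+c≡1+m))
                                   (D-extend m (summand≤ 1≤a (≡.trans (ℕP.+-comm c a) a+c≡1+m))))
                           (⟦cofactor⟧ m a c)) ⟩
      prodBelow m (λ j → pow (X (suc j)) (a / suc j)) * prodBelow m (λ j → pow (X (suc j)) (c / suc j))
        * prodBelow m (λ j → pow (X (suc j)) (T j ∸ (a / suc j ℕ.+ c / suc j))) * X (suc m)
        ≈⟨ *-cong (trans (*-congʳ (sym (prodBelow-* m _ _))) (sym (prodBelow-* m _ _))) (sym (*-identityʳ _)) ⟩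
      prodBelow m (λ j → pow (X (suc j)) (a / suc j) * pow (X (suc j)) (c / suc j)
                         * pow (X (suc j)) (T j ∸ (a / suc j ℕ.+ c / suc j))) * (X (suc m) * 1#)
        ≈⟨ *-cong (prodBelow-cong m λ j _ → exponents-add-up j)
                  (reflexive (≡.cong (pow (X (suc m))) (≡.sym (n/n≡1 (suc m))))) ⟩
      D q t ui (suc m) ∎
      where
      T : ℕ → ℕ
      T j = suc m / suc j
      exponents-add-up : ∀ j → pow (X (suc j)) (a / suc j) * pow (X (suc j)) (c / suc j)
                                 * pow (X (suc j)) (T j ∸ (a / suc j ℕ.+ c / suc j)) ≈ pow (X (suc j)) (T j)
      exponents-add-up j = trans (*-congʳ (sym (pow-+ (X (suc j)) (a / suc j) (c / suc j))))
        (pow-∸ (X (suc j)) (≡.subst (λ n → a / suc j ℕ.+ c / suc j ≤ n / suc j) a+c≡1+m (/-superadditive a c (suc j))))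

    ⟦N-step⟧ : ∀ k → ⟦ N (suc (suc k)) ⟧ ≈
      ⟦ cofactor (suc k) 1 (suc k) ⟧ * (⟦ N 1 ⟧ * ⟦ N (suc k) ⟧)
      + sumBelow k (λ i → t * (pow q (suc (k ∸ i)) * (⟦ cofactor (suc k) (suc i) (suc (k ∸ i)) ⟧
                                                       * (⟦ N (suc i) ⟧ * ⟦ N (suc (k ∸ i)) ⟧))))
    ⟦N-step⟧ k = begin
      ⟦ N (suc (suc k)) ⟧
        ≡⟨ ≡.cong ⟦_⟧ (N-suc (suc k)) ⟩
      ⟦ cofactor (suc k) 1 (suc k) ⊗ M 1 ⊗ M (suc k) ++ sumᴾ k term ⟧
        ≈⟨ ⟦++⟧ (cofactor (suc k) 1 (suc k) ⊗ M 1 ⊗ M (suc k)) (sumᴾ k term) ⟩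
      ⟦ cofactor (suc k) 1 (suc k) ⊗ M 1 ⊗ M (suc k) ⟧ + ⟦ sumᴾ k term ⟧
        ≈⟨ +-cong (trans (⟦⊗⟧ (cofactor (suc k) 1 (suc k)) (M 1 ⊗ M (suc k)))
                         (*-congˡ (trans (⟦⊗⟧ (M 1) (M (suc k))) (*-cong (⟦M⟧ (s≤s z≤n)) (⟦M⟧ ℕP.≤-refl)))))
                  (trans (⟦sumᴾ⟧ k term) (sumBelow-cong k ⟦term⟧)) ⟩
      _ ∎
      where
      M = Nupto (suc k)
      ⟦M⟧ : ∀ {i} → i ≤ suc k → ⟦ M i ⟧ ≈ ⟦ N i ⟧
      ⟦M⟧ i≤1+k = reflexive (≡.cong ⟦_⟧ (Nupto-stable i≤1+k))
      term : ℕ → Poly3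
      term i = tᴾ ⊗ qᴾ ^ᴾ suc (k ∸ i) ⊗ cofactor (suc k) (suc i) (suc (k ∸ i)) ⊗ M (suc i) ⊗ M (suc (k ∸ i))
      ⟦term⟧ : ∀ i → i < k → ⟦ term i ⟧ ≈ t * (pow q (suc (k ∸ i)) * (⟦ cofactor (suc k) (suc i) (suc (k ∸ i)) ⟧
                                                       * (⟦ N (suc i) ⟧ * ⟦ N (suc (k ∸ i)) ⟧)))
      ⟦term⟧ i i<k = begin
        ⟦ tᴾ ⊗ qᴾ ^ᴾ suc j ⊗ K ⊗ M (suc i) ⊗ M (suc j) ⟧
          ≈⟨ ⟦⊗⟧ tᴾ (qᴾ ^ᴾ suc j ⊗ K ⊗ M (suc i) ⊗ M (suc j)) ⟩
        ⟦ tᴾ ⟧ * ⟦ qᴾ ^ᴾ suc j ⊗ K ⊗ M (suc i) ⊗ M (suc j) ⟧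
          ≈⟨ *-congˡ (⟦⊗⟧ (qᴾ ^ᴾ suc j) (K ⊗ M (suc i) ⊗ M (suc j))) ⟩
        ⟦ tᴾ ⟧ * (⟦ qᴾ ^ᴾ suc j ⟧ * ⟦ K ⊗ M (suc i) ⊗ M (suc j) ⟧)
          ≈⟨ *-congˡ (*-congˡ (trans (⟦⊗⟧ K (M (suc i) ⊗ M (suc j))) (*-congˡ (⟦⊗⟧ (M (suc i)) (M (suc j)))))) ⟩
        ⟦ tᴾ ⟧ * (⟦ qᴾ ^ᴾ suc j ⟧ * (⟦ K ⟧ * (⟦ M (suc i) ⟧ * ⟦ M (suc j) ⟧)))
          ≈⟨ *-cong ⟦tᴾ⟧ (*-cong (trans (⟦^ᴾ⟧ qᴾ (suc j)) (pow-cong (suc j) ⟦qᴾ⟧))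
                                 (*-congˡ (*-cong (⟦M⟧ (ℕP.m≤n⇒m≤1+n i<k)) (⟦M⟧ (s≤s (ℕP.m∸n≤m k i)))))) ⟩
        t * (pow q (suc j) * (⟦ K ⟧ * (⟦ N (suc i) ⟧ * ⟦ N (suc j) ⟧))) ∎
        where
        j = k ∸ i
        K = cofactor (suc k) (suc i) (suc j)

    module _ (dinv : ℕ → Carrier) (D·dinv≈1 : ∀ n → D q t ui n * dinv n ≈ 1#) where

      β : ℕ → Carrier
      β i = ⟦ N (suc i) ⟧ * dinv (suc i)

      cofactor-inverse : ∀ m {a c} → 1 ≤ a → 1 ≤ c → a ℕ.+ c ≡ suc m →
        X (suc m) * ⟦ cofactor m a c ⟧ * dinv (suc m) ≈ dinv a * dinv c
      cofactor-inverse m {a} {c} 1≤a 1≤c a+c≡1+m = begin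
        X (suc m) * F * dinv (suc m)
          ≈⟨ *-identityˡ _ ⟨
        1# * (X (suc m) * F * dinv (suc m))
          ≈⟨ *-congʳ (trans (sym (*-identityˡ 1#)) (sym (*-cong (D·dinv≈1 a) (D·dinv≈1 c)))) ⟩
        (D q t ui a * dinv a) * (D q t ui c * dinv c) * (X (suc m) * F * dinv (suc m))
          ≈⟨ solve 7 (λ da ia dc ic x f id → (da :* ia) :* (dc :* ic) :* (x :* f :* id) := (ia :* ic) :* ((da :* dc :* f :* x) :* id)) refl
               (D q t ui a) (dinv a) (D q t ui c) (dinv c) (X (suc m)) F (dinv (suc m)) ⟩
        (dinv a * dinv c) * ((D q t ui a * D q t ui c * F * X (suc m)) * dinv (suc m))
          ≈⟨ *-congˡ (trans (*-congʳ (D-factorisation m 1≤a 1≤c a+c≡1+m)) (D·dinv≈1 (suc m))) ⟩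
        (dinv a * dinv c) * 1#
          ≈⟨ *-identityʳ _ ⟩
        dinv a * dinv c ∎
        where F = ⟦ cofactor m a c ⟧

      β-initial : X 1 * β 0 ≈ 1#
      β-initial = begin
        X 1 * (⟦ N 1 ⟧ * dinv 1)   ≡⟨ ≡.cong (λ f → X 1 * (⟦ f ⟧ * dinv 1)) (N-suc 0) ⟩
        X 1 * (⟦ 1ᴾ ⟧ * dinv 1)    ≈⟨ *-congˡ (*-congʳ ⟦1ᴾ⟧) ⟩
        X 1 * (1# * dinv 1)        ≈⟨ solve 2 (λ x d → x :* (:1 :* d) := :1 :* (x :* :1) :* d) refl (X 1) (dinv 1) ⟩
        D q t ui 1 * dinv 1        ≈⟨ D·dinv≈1 1 ⟩
        1#                         ∎

      β-step : ∀ k → X (suc (suc k)) * β (suc k)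
                     ≈ β 0 * β k + t * q * sumBelow k (λ i → β i * (pow q (k ∸ i) * β (k ∸ i)))
      β-step k = begin
        X n * (⟦ N n ⟧ * dinv n)
          ≈⟨ *-congˡ (*-congʳ (⟦N-step⟧ k)) ⟩
        X n * ((⟦ F₁ ⟧ * (⟦ N 1 ⟧ * ⟦ N (suc k) ⟧) + sumBelow k T) * dinv n)
          ≈⟨ solve 6 (λ x f a b s d → x :* ((f :* (a :* b) :+ s) :* d) := (x :* f :* d) :* (a :* b) :+ x :* (s :* d)) refl
               (X n) ⟦ F₁ ⟧ ⟦ N 1 ⟧ ⟦ N (suc k) ⟧ (sumBelow k T) (dinv n) ⟩
        (X n * ⟦ F₁ ⟧ * dinv n) * (⟦ N 1 ⟧ * ⟦ N (suc k) ⟧) + X n * (sumBelow k T * dinv n)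
          ≈⟨ +-cong (*-congʳ (cofactor-inverse (suc k) (s≤s z≤n) (s≤s z≤n) ≡.refl))
                    (trans (*-congˡ (trans (*-comm _ _) (sumBelow-*ˡ k (dinv n) T))) (sumBelow-*ˡ k (X n) _)) ⟩
        (dinv 1 * dinv (suc k)) * (⟦ N 1 ⟧ * ⟦ N (suc k) ⟧) + sumBelow k (λ i → X n * (dinv n * T i))
          ≈⟨ +-cong (solve 4 (λ a b c d → (a :* b) :* (c :* d) := (c :* a) :* (d :* b)) refl _ _ _ _)
                    (sumBelow-cong k summand) ⟩
        β 0 * β k + sumBelow k (λ i → t * q * (β i * (pow q (k ∸ i) * β (k ∸ i))))
          ≈⟨ +-congˡ (sumBelow-*ˡ k (t * q) _) ⟨
        β 0 * β k + t * q * sumBelow k (λ i → β i * (pow q (k ∸ i) * β (k ∸ i))) ∎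
        where
        n = suc (suc k)
        F₁ = cofactor (suc k) 1 (suc k)
        T = λ i → t * (pow q (suc (k ∸ i)) * (⟦ cofactor (suc k) (suc i) (suc (k ∸ i)) ⟧
                                               * (⟦ N (suc i) ⟧ * ⟦ N (suc (k ∸ i)) ⟧)))
        summand : ∀ i → i < k → X n * (dinv n * T i) ≈ t * q * (β i * (pow q (k ∸ i) * β (k ∸ i)))
        summand i i<k = begin
          X n * (dinv n * T i)
            ≈⟨ solve 8 (λ x d t q p f a c → x :* (d :* (t :* ((q :* p) :* (f :* (a :* c))))) := (t :* q :* p) :* (a :* c) :* (x :* f :* d)) refl
                 (X n) (dinv n) t q (pow q j) ⟦ Fᵢ ⟧ ⟦ N (suc i) ⟧ ⟦ N (suc j) ⟧ ⟩
          (t * q * pow q j) * (⟦ N (suc i) ⟧ * ⟦ N (suc j) ⟧) * (X n * ⟦ Fᵢ ⟧ * dinv n)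
            ≈⟨ *-congˡ (cofactor-inverse (suc k) (s≤s z≤n) (s≤s z≤n) i+j≡k) ⟩
          (t * q * pow q j) * (⟦ N (suc i) ⟧ * ⟦ N (suc j) ⟧) * (dinv (suc i) * dinv (suc j))
            ≈⟨ solve 7 (λ t q p a c da dc → (t :* q :* p) :* (a :* c) :* (da :* dc) := t :* q :* ((a :* da) :* (p :* (c :* dc)))) refl
                 t q (pow q j) ⟦ N (suc i) ⟧ ⟦ N (suc j) ⟧ (dinv (suc i)) (dinv (suc j)) ⟩
          t * q * (β i * (pow q j * β j)) ∎
          where
          j = k ∸ i
          Fᵢ = cofactor (suc k) (suc i) (suc j)
          i+j≡k : suc i ℕ.+ suc j ≡ suc (suc k)
          i+j≡k = ≡.cong suc (≡.trans (ℕP.+-suc i j) (≡.cong suc (ℕP.m+[n∸m]≡n (ℕP.<⇒≤ i<k))))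

      β-recurrence : ∀ k → X (suc (suc k)) * β (suc k) ≈ (1# - q) * β k + t * q * (β *ₛ dilₛ q β) k
      β-recurrence k = begin
        X (suc (suc k)) * β (suc k)
          ≈⟨ β-step k ⟩
        β 0 * β k + t * q * S
          ≈⟨ +-congʳ β₀βₖ ⟩
        ((1# - q) * β k + t * q * (β k * (1# * β 0))) + t * q * S
          ≈⟨ solve 5 (λ w b t q s → (w :+ t :* q :* b) :+ t :* q :* s := w :+ t :* q :* (s :+ b)) refl
               ((1# - q) * β k) (β k * (1# * β 0)) t q S ⟩
        (1# - q) * β k + t * q * (S + β k * (1# * β 0))
          ≈⟨ +-congˡ (*-congˡ (trans (+-congˡ (reflexive (≡.cong (λ j → β k * (pow q j * β j)) (≡.sym (ℕP.n∸n≡0 k)))))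
                                      (sym (sumTo≈sumBelow k _)))) ⟩
        (1# - q) * β k + t * q * (β *ₛ dilₛ q β) k ∎
        where
        S = sumBelow k (λ i → β i * (pow q (k ∸ i) * β (k ∸ i)))
        β₀βₖ : β 0 * β k ≈ (1# - q) * β k + t * q * (β k * (1# * β 0))
        β₀βₖ = sym (begin
          (1# - q) * β k + t * q * (β k * (1# * β 0))
            ≈⟨ +-congʳ (sym (trans (*-congˡ β-initial) (*-identityʳ _))) ⟩
          (1# - q) * β k * (X 1 * β 0) + t * q * (β k * (1# * β 0))
            ≈⟨ solve 5 (λ q u t b b0 → (:1 :- q) :* b :* (((:1 :- (q :* :1) :* t) :* u) :* b0) :+ t :* q :* (b :* (:1 :* b0)) := ((:1 :- q) :* u) :* ((:1 :- q :* t) :* b0 :* b) :+ t :* q :* (b :* b0)) refl q ui t (β k) (β 0) ⟩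
          ((1# - q) * ui) * ((1# - q * t) * β 0 * β k) + t * q * (β k * β 0)
            ≈⟨ +-congʳ (trans (*-congʳ hu) (*-identityˡ _)) ⟩
          (1# - q * t) * β 0 * β k + t * q * (β k * β 0)
            ≈⟨ solve 4 (λ q t b0 b → (:1 :- q :* t) :* b0 :* b :+ t :* q :* (b :* b0) := b0 :* b) refl q t (β 0) (β k) ⟩
          β 0 * β k ∎)

module BesselRatios (R : CommutativeRing 0ℓ 0ℓ) where
  open CommutativeRing R hiding (zero)
  open Q R
  open IntegerCoefficientSolver R
  open PowerSeries R
  open EvenSeries R
  open HahnExtonRiccati R
  open CoefficientRecurrence R
  open import Relation.Binary.Reasoning.Setoid setoid

  module _ (q t qi ti ui : Carrier) (q·qi≈1 : q * qi ≈ 1#) (t·ti≈1 : t * ti ≈ 1#) (hu : (1# - q) * ui ≈ 1#)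
           (dinv : ℕ → Carrier) (D·dinv≈1 : ∀ n → D q t ui n * dinv n ≈ 1#) where

    private
      w : Carrier
      w = 1# - q
      b : Series
      b = β q t ui hu dinv D·dinv≈1
      coeff : ℕ → Carrier
      coeff n = eval3 (NumeratorPolynomials.N n) q t ((1# - t) * ui) * dinv n
    open RiccatiSolutions.FromRecurrence R q t qi ti ui q·qi≈1 t·ti≈1 hu b
      (β-initial q t ui hu dinv D·dinv≈1) (β-recurrence q t ui hu dinv D·dinv≈1)
      using (a₊; P₊; P₊-riccati; a₋; P₋; P₋-riccati)

    ratio-base-q⁻¹ : (e : Carrier) → (c0 c1 : ℕ → Carrier) → (1# - ti * qi) * e ≈ 1# →
      PhiInv qi ti c0 → PhiInv qi (ti * qi) c1 →
      BesselRatioIs qi w e c0 c1 (oddₛ (λ n → - (coeff n * pow (t * q) n)))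
    ratio-base-q⁻¹ e c0 c1 He H0 H1 = riccati⇒BesselRatioIs He H0 H1 P₋-riccati series
      where
      series : oddₛ (λ n → - (coeff n * pow (t * q) n)) ≈ₛ zₛ (evenₛ (w ·ₛ P₋))
      series zero    = refl
      series (suc m) = evenₛ-cong (λ n → sym (begin
        w * (a₋ * (pow (t * q) n * b n))
          ≈⟨ solve 5 (λ q t u y b → (:1 :- q) :* ((:- (t :* q :* u)) :* (y :* b)) := ((:1 :- q) :* u) :* (:- (b :* ((t :* q) :* y)))) refl q t ui (pow (t * q) n) (b n) ⟩
        ((1# - q) * ui) * (- (b n * ((t * q) * pow (t * q) n)))
          ≈⟨ trans (*-congʳ hu) (*-identityˡ _) ⟩
        - (coeff (suc n) * pow (t * q) (suc n)) ∎)) m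

    ratio-base-q : (e : Carrier) → (c0 c1 : ℕ → Carrier) → (1# - t * q) * e ≈ 1# →
      PhiInv q t c0 → PhiInv q (t * q) c1 →
      BesselRatioIs q w e c0 c1 (zₛ (constₛ w) +ₛ oddₛ (λ n → coeff n * (pow q n * t)))
    ratio-base-q e c0 c1 He H0 H1 = riccati⇒BesselRatioIs He H0 H1 P₊-riccati series
      where
      c : ℕ → Carrier
      c n = coeff n * (pow q n * t)
      w·P₊ : w ·ₛ P₊ ≈ₛ (constₛ w +ₛ tailₛ c)
      w·P₊ zero = begin
        w * (1# + a₊ * (1# * b 0))
          ≈⟨ solve 4 (λ q t u b → (:1 :- q) :* (:1 :+ (q :* t :* u) :* (:1 :* b)) := (:1 :- q) :+ ((:1 :- q) :* u) :* (b :* ((q :* :1) :* t))) refl q t ui (b 0) ⟩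
        w + ((1# - q) * ui) * (b 0 * ((q * 1#) * t))
          ≈⟨ +-congˡ (trans (*-congʳ hu) (*-identityˡ _)) ⟩
        w + c 1 ∎
      w·P₊ (suc k) = begin
        w * (0# + a₊ * (x * b (suc k)))
          ≈⟨ solve 5 (λ q t u x b → (:1 :- q) :* (:0 :+ (q :* t :* u) :* (x :* b)) := :0 :+ ((:1 :- q) :* u) :* (b :* ((q :* x) :* t))) refl q t ui x (b (suc k)) ⟩
        0# + ((1# - q) * ui) * (b (suc k) * ((q * x) * t))
          ≈⟨ +-congˡ (trans (*-congʳ hu) (*-identityˡ _)) ⟩
        0# + c (suc (suc k)) ∎
        where x = pow q (suc k)
      series : (zₛ (constₛ w) +ₛ oddₛ c) ≈ₛ zₛ (evenₛ (w ·ₛ P₊))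
      series zero    = +-identityʳ 0#
      series (suc m) = sym (trans (evenₛ-cong w·P₊ m)
        (trans (evenₛ-+ₛ (constₛ w) (tailₛ c) m) (+-congʳ (evenₛ-constₛ w m))))

theorem2p6 : Σ (ℕ → Poly3) λ N →
    (R : CommutativeRing 0ℓ 0ℓ) →
    let open CommutativeRing R
        open Q R
    in
    (q t : Carrier) →
    (qi : Carrier) → q * qi ≈ 1# →
    (ti : Carrier) → t * ti ≈ 1# →
    (ui : Carrier) → (1# - q) * ui ≈ 1# →
    (dinv : ℕ → Carrier) → (∀ n → D q t ui n * dinv n ≈ 1#) →
    let w = 1# - q
        νb = (1# - t) * ui
        coeff = λ n → eval3 (N n) q t νb * dinv n
    in
    ((e : Carrier) → (c0 c1 : ℕ → Carrier) → (1# - ti * qi) * e ≈ 1# →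
      PhiInv qi ti c0 → PhiInv qi (ti * qi) c1 →
      BesselRatioIs qi w e c0 c1
        (oddₛ (λ n → - (coeff n * pow (t * q) n))))
    ×
    ((e : Carrier) → (c0 c1 : ℕ → Carrier) → (1# - t * q) * e ≈ 1# →
      PhiInv q t c0 → PhiInv q (t * q) c1 →
      BesselRatioIs q w e c0 c1
        (zₛ (constₛ w) +ₛ oddₛ (λ n → coeff n * (pow q n * t))))
theorem2p6 = NumeratorPolynomials.N , λ R q t qi q·qi≈1 ti t·ti≈1 ui hu dinv D·dinv≈1 →
  let open BesselRatios R in
  ratio-base-q⁻¹ q t qi ti ui q·qi≈1 t·ti≈1 hu dinv D·dinv≈1 ,
  ratio-base-q   q t qi ti ui q·qi≈1 t·ti≈1 hu dinv D·dinv≈1
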